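{- Let $\lambda$ be a partition, $n\in N(\lambda)$, $O\in\mathrm{OT}_n(\lambda)$, $a_O=\mathrm{des}\,O$, and $C=\{\mathrm{com}(S)\mid S\in\mathrm{SSOT}_n(\lambda),\ \mathrm{std}\,S=O\}$. Then the set of strong compositions lying in $C$ is exactly $\mathrm{ref}(a_O)$.
   Context: Partitions are Young diagrams (English convention); a box is a position $(i,j)$, $i$ = row, $j$ = column. For boxes $B_1=(i_1,j_1)$, $B_2=(i_2,j_2)$ write $B_1<_{nE}B_2$ if $i_1\ge i_2$ and $j_1<j_2$. A skew shape is a horizontal strip if it has at most one box in each column. $N(\lambda)=\{n\ge|\lambda|: n\equiv|\lambda|\pmod 2\}$. A weak (resp. strong) composition is a finite sequence of nonnegative (resp. positive) integers; weak compositions differing only by trailing zeros are identified. A strong composition $b$ refines a strong composition $a=(a_1,\dots,a_m)$ if $b$ is obtained by replacing each part $a_j$ by a sequence of positive integers summing to $a_j$ (in order); $\mathrm{ref}(a)$ is the set of strong compositions refining $a$ (including $a$). For partitions write $\nu\lhd\mu$ if $\nu\subset\mu$, $|\mu|=|\nu|+1$. An OT of shape $\lambda$ and length $n$ is $O=(O_0,\dots,O_n)$ with $O_0=\emptyset$, $O_n=\lambda$, and for each $j\in[n]$ either $O_{j-1}\lhd O_j$ ($j$ is an addition) or $O_j\lhd O_{j-1}$ ($j$ is a deletion); $B_j$ is the box in which $O_{j-1}$ and $O_j$ differ. $\mathrm{OT}_n(\lambda)$ is the set of these. Descent composition: split $\{1,\dots,n\}$ into consecutive blocks, where $1$ starts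 a block and, for $2\le j\le n$, $j$ is in the same block as $j-1$ iff (a) $j-1,j$ are both additions and $B_{j-1}<_{nE}B_j$, or (b) $j-1,j$ are both deletions and $B_j<_{nE}B_{j-1}$, or (c) $j-1$ is a deletion and $j$ is an addition. Then $\mathrm{des}\,O$ is the sequence of block lengths and $\mathrm{step}\,O$ the number of blocks. An SSOT of shape $\lambda$ is a sequence of partitions $S=(S^1,S'^2,S^2,S'^3,\dots)$ such that, with $S^0=S'^1=\emptyset$: for all $i\ge1$, $S'^i\subseteq S^{i-1}$, $S'^i\subseteq S^i$, and $S^{i-1}/S'^i$, $S^i/S'^i$ are horizontal strips (possibly empty); and $S^i=S'^{i+1}=\lambda$ for all large $i$. Put $m_i(S)=|S^{i-1}/S'^i|+|S^i/S'^i|$, length $n=\sum_i m_i(S)$, $\mathrm{com}(S)=(m_1(S),m_2(S),\dots)$. $\mathrm{SSOT}_n(\lambda)$ is the set of SSOTs of shape $\lambda$ and length $n$. The standardization $\mathrm{std}\,S\in\mathrm{OT}_n(\lambda)$ is obtained from $\emptyset$ by, for $i=1,2,\dots$, first removing the boxes of $S^{i-1}/S'^i$ one by one from right to left, then adding the boxes of $S^i/S'^i$ one by one from left to right. -}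

module Defs where

open import Data.Bool using (Bool; true; false; if_then_else_; _∧_; _∨_; not)
open import Data.Nat using (ℕ; zero; suc; _+_; _∸_; _≤_; _<_; _≤ᵇ_; _<ᵇ_; _≡ᵇ_; _%_)
open import Data.Product using (Σ; _×_; _,_; proj₁; proj₂)
open import Data.Maybe using (Maybe; just; nothing)
open import Data.List using (List; []; _∷_; _++_; length; map; upTo; reverse; concat; concatMap; head; last)
open import Data.Nat.ListAction using (sum)
open import Data.List.Relation.Unary.All using (All)
open import Data.List.Relation.Unary.Linked using (Linked)
open import Data.List.Relation.Binary.Pointwise using (Pointwise)
open import Data.Sum using (_⊎_)
open import Relation.Binary.PropositionalEquality using (_≡_)

-- Partitions: lists of row lengths, weakly decreasing, all parts positive
-- (canonical representation, no trailing zeros).  Rows and columns are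
-- 0-indexed; box (i , j) lies in λ iff j < part λ i.

Partition : Set
Partition = List ℕ

IsPartition : List ℕ → Set
IsPartition xs = Linked (λ a b → b ≤ a) xs × All (0 <_) xs

part : List ℕ → ℕ → ℕ
part []       _       = 0
part (x ∷ xs) zero    = x
part (x ∷ xs) (suc i) = part xs i

size : List ℕ → ℕ
size = sum

Box : Set
Box = ℕ × ℕ

_∈D_ : Box → List ℕ → Set
(i , j) ∈D lam = j < part lam i

_⊆P_ : List ℕ → List ℕ → Set
ν ⊆P μ = ∀ (b : Box) → b ∈D ν → b ∈D μ

_⊲_ : List ℕ → List ℕ → Set
ν ⊲ μ = ν ⊆P μ × size μ ≡ suc (size ν)

InSkew : List ℕ → List ℕ → Box → Set
InSkew μ ν b = b ∈D μ × (b ∈D ν → Data.Empty.⊥)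
  where import Data.Empty

HorizontalStrip : List ℕ → List ℕ → Set
HorizontalStrip μ ν = ∀ i₁ i₂ j → InSkew μ ν (i₁ , j) → InSkew μ ν (i₂ , j) → i₁ ≡ i₂

InN : List ℕ → ℕ → Set
InN lam n = size lam ≤ n × n % 2 ≡ size lam % 2

record IsOT (lam : List ℕ) (n : ℕ) (O : List (List ℕ)) : Set where
  field
    len     : length O ≡ suc n
    allPart : All IsPartition O
    start   : head O ≡ just []
    end     : last O ≡ just lam
    moves   : Linked (λ P Q → P ⊲ Q ⊎ Q ⊲ P) O

firstTrue : (ℕ → Bool) → List ℕ → ℕ
firstTrue p []       = 0
firstTrue p (i ∷ is) = if p i then i else firstTrue p is

boxDiff : List ℕ → List ℕ → Box
boxDiff small big =
  let i = firstTrue (λ r → not (part small r ≡ᵇ part big r))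
                    (upTo (suc (length small + length big)))
  in i , part small i

-- a step: (is it an addition?, its box B_j)
Step : Set
Step = Bool × Box

step : List ℕ → List ℕ → Step
step P Q = if size P <ᵇ size Q then (true , boxDiff P Q) else (false , boxDiff Q P)

stepsOf : List (List ℕ) → List Step
stepsOf (P ∷ Q ∷ rest) = step P Q ∷ stepsOf (Q ∷ rest)
stepsOf _              = []

nE : Box → Box → Bool
nE (i₁ , j₁) (i₂ , j₂) = (i₂ ≤ᵇ i₁) ∧ (j₁ <ᵇ j₂)

-- does step j (second argument) lie in the same block as step j-1 (first)?
joins : Step → Step → Bool
joins (a₁ , b₁) (a₂ , b₂) =
  (a₁ ∧ a₂ ∧ nE b₁ b₂) ∨ (not a₁ ∧ not a₂ ∧ nE b₂ b₁) ∨ (not a₁ ∧ a₂)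

desGo : Step → ℕ → List Step → List ℕ
desGo prev k []       = k ∷ []
desGo prev k (t ∷ ts) = if joins prev t then desGo t (suc k) ts else k ∷ desGo t 1 ts

desSteps : List Step → List ℕ
desSteps []       = []
desSteps (s ∷ ss) = desGo s 1 ss

des : List (List ℕ) → List ℕ
des O = desSteps (stepsOf O)

StrongComp : List ℕ → Set
StrongComp = All (0 <_)

Refines : List ℕ → List ℕ → Set
Refines b a = Σ (List (List ℕ)) λ bs →
  concat bs ≡ b × Pointwise (λ blk aj → All (0 <_) blk × sum blk ≡ aj) bs a

InRef : List ℕ → List ℕ → Set
InRef a b = StrongComp b × Refines b a

-- Semistandard oscillating tableaux.
-- S i = S^i, S′ i = S'^{i+1}  (so S 0 = S^0 = ∅ and S′ 0 = S'^1 = ∅).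

record SSOT (lam : List ℕ) : Set where
  field
    S        : ℕ → List ℕ
    S′       : ℕ → List ℕ
    S-part   : ∀ i → IsPartition (S i)
    S′-part  : ∀ i → IsPartition (S′ i)
    S-zero   : S 0 ≡ []
    S′-zero  : S′ 0 ≡ []
    sub-left    : ∀ i → S′ i ⊆P S i
    sub-right   : ∀ i → S′ i ⊆P S (suc i)
    strip-left  : ∀ i → HorizontalStrip (S i) (S′ i)
    strip-right : ∀ i → HorizontalStrip (S (suc i)) (S′ i)
    stab     : ℕ
    stable   : ∀ i → stab ≤ i → S i ≡ lam × S′ i ≡ lam

open SSOT public

-- m_{i+1}(S) = |S^i / S'^{i+1}| + |S^{i+1} / S'^{i+1}|
mult : ∀ {lam} → SSOT lam → ℕ → ℕ
mult T i = (size (S T i) ∸ size (S′ T i)) + (size (S T (suc i)) ∸ size (S′ T i))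

-- length of S: Σ_i m_i(S)  (m_i = 0 beyond the stabilisation index)
ssotLength : ∀ {lam} → SSOT lam → ℕ
ssotLength T = sum (map (mult T) (upTo (stab T)))

-- com(S) agrees with the weak composition b (up to trailing zeros)
ComEq : ∀ {lam} → SSOT lam → List ℕ → Set
ComEq T b = ∀ i → mult T i ≡ part b i

trim : List ℕ → List ℕ
trim []       = []
trim (x ∷ xs) with trim xs
... | [] = if x ≡ᵇ 0 then [] else x ∷ []
... | ys = x ∷ ys

setAt : ℕ → ℕ → List ℕ → List ℕ
setAt i v xs = trim (go i xs)
  where
    go : ℕ → List ℕ → List ℕ
    go zero    []       = v ∷ []
    go zero    (x ∷ ys) = v ∷ ys
    go (suc k) []       = 0 ∷ go k []
    go (suc k) (x ∷ ys) = x ∷ go k ys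

findRow : List ℕ → List ℕ → ℕ → Maybe ℕ
findRow big small c = go (upTo (length big))
  where
    go : List ℕ → Maybe ℕ
    go []       = nothing
    go (i ∷ is) = if (part small i ≤ᵇ c) ∧ (c <ᵇ part big i) then just i else go is

removeCols : List ℕ → List ℕ → List ℕ → List ℕ → List (List ℕ)
removeCols big small []       cur = []
removeCols big small (c ∷ cs) cur with findRow big small c
... | nothing = removeCols big small cs cur
... | just i  = setAt i c cur ∷ removeCols big small cs (setAt i c cur)

addCols : List ℕ → List ℕ → List ℕ → List ℕ → List (List ℕ)
addCols big small []       cur = []
addCols big small (c ∷ cs) cur with findRow big small c
... | nothing = addCols big small cs cur
... | just i  = setAt i (suc c) cur ∷ addCols big small cs (setAt i (suc c) cur)

removeSeq : List ℕ → List ℕ → List (List ℕ)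
removeSeq ν κ = removeCols ν κ (reverse (upTo (part ν 0))) ν

addSeq : List ℕ → List ℕ → List (List ℕ)
addSeq κ μ = addCols μ κ (upTo (part μ 0)) κ

std : ∀ {lam} → SSOT lam → List (List ℕ)
std T = [] ∷ concatMap (λ i → removeSeq (S T i) (S′ T i) ++ addSeq (S′ T i) (S T (suc i)))
                       (upTo (stab T))

InC : List ℕ → ℕ → List (List ℕ) → List ℕ → Set
InC lam n O b = Σ (SSOT lam) λ T → ssotLength T ≡ n × std T ≡ O × ComEq T b

{-# OPTIONS --safe #-}
module Submission where

open import Defs
open import Data.Bool using (Bool; true; false; if_then_else_; _∧_; not; T)
open import Data.Bool.Properties using (T-∧; T-≡; ∨-identityʳ)
open import Data.Nat using (ℕ; zero; suc; _+_; _∸_; _≤_; _<_; _≤ᵇ_; _<ᵇ_; _≡ᵇ_; _⊔_; _⊓_; z≤n; s≤s; z<s; _≟_; _≤?_; _<?_)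
open import Data.Nat.Properties
open import Data.Nat.ListAction using (sum)
open import Data.Nat.ListAction.Properties using (sum-++)
open import Data.List using (List; []; _∷_; _++_; length; map; upTo; downFrom; applyUpTo; concat; last; findᵇ; take; drop)
open import Data.List.Properties using (reverse-upTo; length-++; length-take; length-drop; take++drop≡id; ++-assoc; ++-identityʳ; map-++; concat-++; ∷-injectiveˡ; ∷-injectiveʳ; map-∘; map-cong; map-upTo)
open import Data.List.Relation.Unary.All using (All; []; _∷_)
open import Data.List.Relation.Unary.Linked using (Linked; []; [-]; _∷_)
import Data.List.Relation.Unary.Linked as Linked
import Data.List.Relation.Unary.All as All
import Data.List.Relation.Unary.All.Properties as All
open import Data.List.Relation.Binary.Pointwise using (Pointwise; []; _∷_)
open import Data.Maybe using (Maybe; just; nothing)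
open import Data.Maybe.Properties using (just-injective)
open import Data.Product using (Σ; _×_; _,_; proj₁; proj₂)
open import Data.Sum using (_⊎_; inj₁; inj₂)
open import Data.Empty using (⊥-elim)
open import Data.Unit using (tt)
open import Function using (_∘_)
open import Function.Bundles using (_⇔_; mk⇔; Equivalence)
open import Relation.Binary.PropositionalEquality
open import Relation.Nullary using (¬_; yes; no; contradiction)

-- Standardizing an SSOT S runs through its steps S^{i-1} ⊇ S'^i ⊆ S^i, removing the horizontal
-- strip S^{i-1}/S'^i from right to left and then adding S^i/S'^i from left to right. Consecutive
-- moves of such a segment always lie in one descent block: deletions from a horizontal strip move
-- strictly left and weakly down, additions strictly right and weakly up, and an addition may follow
-- a deletion. Hence the block boundaries of std S are segment boundaries, and a strong com(S)
-- refines des(std S). Conversely, a run of moves inside one block is a sequence of deletions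
-- moving strictly left followed by additions moving strictly right; the deleted and the added boxes
-- then form horizontal strips, and the run is the standardization of that step. Cutting O into runs
-- whose lengths are the parts of a refinement b of des O thus produces an SSOT S with std S = O and
-- com(S) = b.

-- Row lengths

_≈ₚ_ : List ℕ → List ℕ → Set
xs ≈ₚ ys = ∀ i → part xs i ≡ part ys i

consTrimmed : ℕ → List ℕ → List ℕ
consTrimmed x []       = if x ≡ᵇ 0 then [] else x ∷ []
consTrimmed x (y ∷ ys) = x ∷ y ∷ ys

trim-∷ : ∀ x xs → trim (x ∷ xs) ≡ consTrimmed x (trim xs)
trim-∷ x xs with trim xs
... | []     = refl
... | _ ∷ _  = refl

consTrimmed≈ₚ∷ : ∀ x ys → consTrimmed x ys ≈ₚ (x ∷ ys)
consTrimmed≈ₚ∷ zero    []      zero    = refl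
consTrimmed≈ₚ∷ zero    []      (suc i) = refl
consTrimmed≈ₚ∷ (suc x) []      i       = refl
consTrimmed≈ₚ∷ x       (_ ∷ _) i       = refl

sum-consTrimmed : ∀ x ys → sum (consTrimmed x ys) ≡ sum (x ∷ ys)
sum-consTrimmed zero    []      = refl
sum-consTrimmed (suc x) []      = refl
sum-consTrimmed x       (_ ∷ _) = refl

trim≈ₚ : ∀ xs → trim xs ≈ₚ xs
trim≈ₚ []       i       = refl
trim≈ₚ (x ∷ xs) i rewrite trim-∷ x xs = trans (consTrimmed≈ₚ∷ x (trim xs) i) (tail i)
  where
  tail : ∀ i → part (x ∷ trim xs) i ≡ part (x ∷ xs) i
  tail zero    = refl
  tail (suc i) = trim≈ₚ xs i

sum-trim : ∀ xs → sum (trim xs) ≡ sum xs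
sum-trim []       = refl
sum-trim (x ∷ xs) rewrite trim-∷ x xs =
  trans (sum-consTrimmed x (trim xs)) (cong (x +_) (sum-trim xs))

trim-≈ₚ[] : ∀ xs → xs ≈ₚ [] → trim xs ≡ []
trim-≈ₚ[] []       _ = refl
trim-≈ₚ[] (x ∷ xs) z rewrite trim-∷ x xs | trim-≈ₚ[] xs (λ i → z (suc i)) | z 0 = refl

trim-cong : ∀ xs ys → xs ≈ₚ ys → trim xs ≡ trim ys
trim-cong []       []       _ = refl
trim-cong []       (y ∷ ys) e = sym (trim-≈ₚ[] (y ∷ ys) (λ i → sym (e i)))
trim-cong (x ∷ xs) []       e = trim-≈ₚ[] (x ∷ xs) e
trim-cong (x ∷ xs) (y ∷ ys) e
  rewrite trim-∷ x xs | trim-∷ y ys | e 0 | trim-cong xs ys (λ i → e (suc i)) = refl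

sum-cong : ∀ xs ys → xs ≈ₚ ys → sum xs ≡ sum ys
sum-cong xs ys e = begin
  sum xs        ≡⟨ sum-trim xs ⟨
  sum (trim xs) ≡⟨ cong sum (trim-cong xs ys e) ⟩
  sum (trim ys) ≡⟨ sum-trim ys ⟩
  sum ys        ∎
  where open ≡-Reasoning

trim-idem : ∀ xs → trim (trim xs) ≡ trim xs
trim-idem xs = trim-cong (trim xs) xs (trim≈ₚ xs)

trim-positive : ∀ {xs} → All (0 <_) xs → trim xs ≡ xs
trim-positive {[]}     []         = refl
trim-positive {x ∷ xs} (x>0 ∷ ps) rewrite trim-∷ x xs | trim-positive ps = cons xs x>0
  where
  cons : ∀ {x} ys → 0 < x → consTrimmed x ys ≡ x ∷ ys
  cons {suc _} []      _ = refl
  cons         (_ ∷ _) _ = refl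

overwrite : ℕ → ℕ → List ℕ → List ℕ
overwrite zero    v []       = v ∷ []
overwrite zero    v (_ ∷ ys) = v ∷ ys
overwrite (suc k) v []       = 0 ∷ overwrite k v []
overwrite (suc k) v (x ∷ ys) = x ∷ overwrite k v ys

-- `setAt` and `findRow` compute through `where`-bound helpers that cannot be named here. Once
-- the helper's hidden parameters are `with`-abstracted (and `trim`, so that it does not reduce),
-- the helper is an unknown function found by unification and determined by its defining
-- equations. Hence `padding`, `filling` and `search` leave their types to unification, and live
-- in a context that does not contain the helper's arguments.

padding-unique : {g : ℕ → ℕ → ℕ → List ℕ} →
  (∀ p v → g p v zero ≡ v ∷ []) → (∀ p v k → g p v (suc k) ≡ 0 ∷ g p v k) →
  ∀ p v k → g p v k ≡ overwrite k v []
padding-unique         e₀ e₁ p v zero    = e₀ p v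
padding-unique {g = g} e₀ e₁ p v (suc k) =
  trans (e₁ p v k) (cong (0 ∷_) (padding-unique {g = g} e₀ e₁ p v k))

overwrite-unique : {g : ℕ → ℕ → List ℕ → ℕ → List ℕ → List ℕ} →
  (∀ p v q → g p v q zero [] ≡ v ∷ []) → (∀ p v q x ys → g p v q zero (x ∷ ys) ≡ v ∷ ys) →
  (∀ p v q k → g p v q (suc k) [] ≡ 0 ∷ g p v q k []) →
  (∀ p v q k x ys → g p v q (suc k) (x ∷ ys) ≡ x ∷ g p v q k ys) →
  ∀ p v q k ys → g p v q k ys ≡ overwrite k v ys
overwrite-unique e₁ e₂ e₃ e₄ p v q zero    []       = e₁ p v q
overwrite-unique e₁ e₂ e₃ e₄ p v q zero    (x ∷ ys) = e₂ p v q x ys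
overwrite-unique {g = g} e₁ e₂ e₃ e₄ p v q (suc k) [] =
  trans (e₃ p v q k) (cong (0 ∷_) (overwrite-unique {g = g} e₁ e₂ e₃ e₄ p v q k []))
overwrite-unique {g = g} e₁ e₂ e₃ e₄ p v q (suc k) (x ∷ ys) =
  trans (e₄ p v q k x ys) (cong (x ∷_) (overwrite-unique {g = g} e₁ e₂ e₃ e₄ p v q k ys))

setAt≡trim∘overwrite : ∀ i v xs → setAt i v xs ≡ trim (overwrite i v xs)
setAt≡trim∘overwrite = proof
  where
  padding : ∀ p v k → _
  padding = padding-unique (λ _ _ → refl) (λ _ _ _ → refl)
  filling : ∀ p v q k ys → _
  filling = overwrite-unique (λ _ _ _ → refl) (λ _ _ _ _ _ → refl) (λ _ _ _ _ → refl)
                             (λ _ _ _ _ _ _ → refl)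
  proof : ∀ i v xs → setAt i v xs ≡ trim (overwrite i v xs)
  proof i v xs with trim
  proof zero    v []       | _ = refl
  proof zero    v (x ∷ ys) | _ = refl
  proof (suc k) v []       | t with suc k
  ... | p = cong (λ z → t (0 ∷ z)) (padding p v k)
  proof (suc k) v (x ∷ ys) | t with suc k | x ∷ ys
  ... | p | q = cong (λ z → t (x ∷ z)) (filling p v q k ys)

findᵇ-unique : ∀ (C : ℕ → Bool) {g : List ℕ → Maybe ℕ} → g [] ≡ nothing →
  (∀ i is → g (i ∷ is) ≡ (if C i then just i else g is)) → ∀ is → g is ≡ findᵇ C is
findᵇ-unique C         e₀ e₁ []       = e₀
findᵇ-unique C {g = g} e₀ e₁ (i ∷ is) =
  trans (e₁ i is) (cong (if C i then just i else_) (findᵇ-unique C {g = g} e₀ e₁ is))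

inStripᵇ : List ℕ → List ℕ → ℕ → ℕ → Bool
inStripᵇ big small c i = (part small i ≤ᵇ c) ∧ (c <ᵇ part big i)

findRow≡findᵇ : ∀ big small c →
  findRow big small c ≡ findᵇ (inStripᵇ big small c) (upTo (length big))
findRow≡findᵇ big small c = proof
  where
  search : ∀ is → _
  search = findᵇ-unique (inStripᵇ big small c) refl (λ _ _ → refl)
  proof : findRow big small c ≡ findᵇ (inStripᵇ big small c) (upTo (length big))
  proof with upTo (length big)
  ... | is = search is

part-overwrite-≡ : ∀ i v xs → part (overwrite i v xs) i ≡ v
part-overwrite-≡ zero    v []       = refl
part-overwrite-≡ zero    v (_ ∷ _)  = refl
part-overwrite-≡ (suc i) v []       = part-overwrite-≡ i v []
part-overwrite-≡ (suc i) v (_ ∷ xs) = part-overwrite-≡ i v xs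

part-overwrite-≢ : ∀ i v xs k → k ≢ i → part (overwrite i v xs) k ≡ part xs k
part-overwrite-≢ zero    v []       zero    k≢i = contradiction refl k≢i
part-overwrite-≢ zero    v []       (suc k) k≢i = refl
part-overwrite-≢ zero    v (_ ∷ _)  zero    k≢i = contradiction refl k≢i
part-overwrite-≢ zero    v (_ ∷ _)  (suc k) k≢i = refl
part-overwrite-≢ (suc i) v []       zero    k≢i = refl
part-overwrite-≢ (suc i) v []       (suc k) k≢i = part-overwrite-≢ i v [] k (k≢i ∘ cong suc)
part-overwrite-≢ (suc i) v (_ ∷ _)  zero    k≢i = refl
part-overwrite-≢ (suc i) v (_ ∷ xs) (suc k) k≢i = part-overwrite-≢ i v xs k (k≢i ∘ cong suc)

part-setAt-≡ : ∀ i v xs → part (setAt i v xs) i ≡ v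
part-setAt-≡ i v xs rewrite setAt≡trim∘overwrite i v xs =
  trans (trim≈ₚ (overwrite i v xs) i) (part-overwrite-≡ i v xs)

part-setAt-≢ : ∀ i v xs k → k ≢ i → part (setAt i v xs) k ≡ part xs k
part-setAt-≢ i v xs k k≢i rewrite setAt≡trim∘overwrite i v xs =
  trans (trim≈ₚ (overwrite i v xs) k) (part-overwrite-≢ i v xs k k≢i)

trim-setAt : ∀ i v xs → trim (setAt i v xs) ≡ setAt i v xs
trim-setAt i v xs rewrite setAt≡trim∘overwrite i v xs = trim-idem (overwrite i v xs)

sum-overwrite : ∀ i v xs → sum (overwrite i v xs) + part xs i ≡ sum xs + v
sum-overwrite zero    v []       = trans (+-identityʳ (v + 0)) (+-identityʳ v)
sum-overwrite zero    v (x ∷ xs) = begin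
  v + sum xs + x  ≡⟨ +-assoc v (sum xs) x ⟩
  v + (sum xs + x) ≡⟨ +-comm v (sum xs + x) ⟩
  sum xs + x + v  ≡⟨ cong (_+ v) (+-comm (sum xs) x) ⟩
  x + sum xs + v  ∎
  where open ≡-Reasoning
sum-overwrite (suc i) v []       = sum-overwrite i v []
sum-overwrite (suc i) v (x ∷ xs) = begin
  x + sum (overwrite i v xs) + part xs i   ≡⟨ +-assoc x _ (part xs i) ⟩
  x + (sum (overwrite i v xs) + part xs i) ≡⟨ cong (x +_) (sum-overwrite i v xs) ⟩
  x + (sum xs + v)                         ≡⟨ +-assoc x (sum xs) v ⟨
  x + sum xs + v                           ∎
  where open ≡-Reasoning

¬T⇒≡false : ∀ {b} → ¬ T b → b ≡ false
¬T⇒≡false {false} _   = refl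
¬T⇒≡false {true}  ¬tt = contradiction tt ¬tt

findᵇ-just : ∀ (C : ℕ → Bool) is i → findᵇ C is ≡ just i → T (C i)
findᵇ-just C (j ∷ is) i e with C j in Cj
... | true  = subst (T ∘ C) (just-injective e) (subst T (sym Cj) tt)
... | false = findᵇ-just C is i e

findᵇ-nothing : ∀ (C : ℕ → Bool) f N → findᵇ C (applyUpTo f N) ≡ nothing →
  ∀ k → k < N → ¬ T (C (f k))
findᵇ-nothing C f (suc N) e k k<N Cfk with C (f 0) in Cf0
findᵇ-nothing C f (suc N) () k k<N Cfk | true
findᵇ-nothing C f (suc N) e zero k<N Cfk | false = subst T Cf0 Cfk
findᵇ-nothing C f (suc N) e (suc k) k<N Cfk | false =
  findᵇ-nothing C (f ∘ suc) N e k (≤-pred k<N) Cfk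

firstTrue-applyUpTo : ∀ (p : ℕ → Bool) f N r → r < N → p (f r) ≡ true →
  (∀ k → k < r → p (f k) ≡ false) → firstTrue p (applyUpTo f N) ≡ f r
firstTrue-applyUpTo p f (suc N) zero    r<N pr earlier rewrite pr = refl
firstTrue-applyUpTo p f (suc N) (suc r) r<N pr earlier rewrite earlier 0 z<s =
  firstTrue-applyUpTo p (f ∘ suc) N r (≤-pred r<N) pr (λ k k<r → earlier (suc k) (s≤s k<r))

InStrip : List ℕ → List ℕ → ℕ → ℕ → Set
InStrip big small i c = part small i ≤ c × c < part big i

inStripᵇ-sound : ∀ big small c i → T (inStripᵇ big small c i) → InStrip big small i c
inStripᵇ-sound big small c i t with Equivalence.to T-∧ t
... | t₁ , t₂ = ≤ᵇ⇒≤ _ _ t₁ , <ᵇ⇒< _ _ t₂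

inStripᵇ-complete : ∀ big small c i → InStrip big small i c → T (inStripᵇ big small c i)
inStripᵇ-complete big small c i (small≤c , c<big) =
  Equivalence.from T-∧ (≤⇒≤ᵇ small≤c , <⇒<ᵇ c<big)

part>0⇒<length : ∀ xs r → 0 < part xs r → r < length xs
part>0⇒<length (x ∷ xs) zero    _  = s≤s z≤n
part>0⇒<length (x ∷ xs) (suc r) xr = s≤s (part>0⇒<length xs r xr)

findRow-just : ∀ big small c i → findRow big small c ≡ just i → InStrip big small i c
findRow-just big small c i e = inStripᵇ-sound big small c i
  (findᵇ-just (inStripᵇ big small c) (upTo (length big)) i (trans (sym (findRow≡findᵇ big small c)) e))

findRow-nothing : ∀ big small c → findRow big small c ≡ nothing → ∀ i → ¬ InStrip big small i c
findRow-nothing big small c e i box@(_ , c<big) =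
  findᵇ-nothing (inStripᵇ big small c) (λ k → k) (length big)
    (trans (sym (findRow≡findᵇ big small c)) e) i
    (part>0⇒<length big i (≤-<-trans z≤n c<big)) (inStripᵇ-complete big small c i box)

-- Single-box moves

record ExtendsAt (P Q : List ℕ) (r : ℕ) : Set where
  constructor extends
  field
    grown  : part P r ≡ suc (part Q r)
    others : ∀ k → k ≢ r → part P k ≡ part Q k

ExtendsAt-size : ∀ {P Q r} → ExtendsAt P Q r → sum P ≡ suc (sum Q)
ExtendsAt-size {P} {Q} {r} (extends Pr Pk) = +-cancelʳ-≡ (part Q r) _ _ (begin
  sum P + part Q r                             ≡⟨ sum-overwrite r (part Q r) P ⟨
  sum (overwrite r (part Q r) P) + part P r    ≡⟨ cong₂ _+_ (sum-cong (overwrite r (part Q r) P) Q overwritten) Pr ⟩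
  sum Q + suc (part Q r)                       ≡⟨ +-suc (sum Q) (part Q r) ⟩
  suc (sum Q) + part Q r                       ∎)
  where
  open ≡-Reasoning
  overwritten : overwrite r (part Q r) P ≈ₚ Q
  overwritten k with k ≟ r
  ... | yes refl = part-overwrite-≡ r (part Q r) P
  ... | no k≢r   = trans (part-overwrite-≢ r (part Q r) P k k≢r) (Pk k k≢r)

ExtendsAt⇒part≤ : ∀ {P Q r} → ExtendsAt P Q r → ∀ k → part Q k ≤ part P k
ExtendsAt⇒part≤ {P} {Q} {r} (extends Pr Pk) k with k ≟ r
... | yes refl = subst (part Q k ≤_) (sym Pr) (n≤1+n _)
... | no k≢r   = ≤-reflexive (sym (Pk k k≢r))

boxDiff-first : ∀ P Q r → (∀ k → k < r → part P k ≡ part Q k) → part P r ≢ part Q r →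
  r < suc (length P + length Q) → boxDiff P Q ≡ (r , part P r)
boxDiff-first P Q r same differ r<bound
  rewrite firstTrue-applyUpTo (λ k → not (part P k ≡ᵇ part Q k)) (λ k → k)
            (suc (length P + length Q)) r r<bound
            (cong not (¬T⇒≡false (differ ∘ ≡ᵇ⇒≡ _ _)))
            (λ k k<r → cong not (Equivalence.to T-≡ (≡⇒≡ᵇ _ _ (same k k<r)))) = refl

module _ {P Q : List ℕ} {r : ℕ} (ext : ExtendsAt P Q r) where

  private
    r<bound : r < suc (length Q + length P)
    r<bound = ≤-trans (part>0⇒<length P r (subst (0 <_) (sym (ExtendsAt.grown ext)) z<s))
                      (≤-trans (m≤n+m (length P) (length Q)) (n≤1+n _))

    earlier-same : ∀ k → k < r → part Q k ≡ part P k
    earlier-same k k<r = sym (ExtendsAt.others ext k (λ k≡r → <-irrefl k≡r k<r))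

    differ : part Q r ≢ part P r
    differ Qr≡Pr = 1+n≢n (trans (sym (ExtendsAt.grown ext)) (sym Qr≡Pr))

  step-deletion : step P Q ≡ (false , r , part Q r)
  step-deletion rewrite ExtendsAt-size ext
    | ¬T⇒≡false (n≮n (sum Q) ∘ <-trans (n<1+n (sum Q)) ∘ <ᵇ⇒< _ _) =
    cong (false ,_) (boxDiff-first Q P r earlier-same differ r<bound)

  step-addition : step Q P ≡ (true , r , part Q r)
  step-addition rewrite ExtendsAt-size ext
    | Equivalence.to T-≡ (<⇒<ᵇ (n<1+n (sum Q))) =
    cong (true ,_) (boxDiff-first Q P r earlier-same differ r<bound)

⊆P⇒part≤ : ∀ ν μ → ν ⊆P μ → ∀ k → part ν k ≤ part μ k
⊆P⇒part≤ ν μ ν⊆μ k with part ν k in νk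
... | zero  = z≤n
... | suc p = ν⊆μ (k , p) (subst (p <_) (sym νk) (n<1+n p))

part≤⇒⊆P : ∀ ν μ → (∀ k → part ν k ≤ part μ k) → ν ⊆P μ
part≤⇒⊆P ν μ ν≤μ (i , j) j<νi = <-≤-trans j<νi (ν≤μ i)

sum-mono : ∀ P Q → (∀ k → part P k ≤ part Q k) → sum P ≤ sum Q
sum-mono []      Q       P≤Q = z≤n
sum-mono (x ∷ P) []      P≤Q = +-mono-≤ (P≤Q 0) (sum-mono P [] (P≤Q ∘ suc))
sum-mono (x ∷ P) (y ∷ Q) P≤Q = +-mono-≤ (P≤Q 0) (sum-mono P Q (P≤Q ∘ suc))

+-≤-≡-split : ∀ {a b c d} → a ≤ b → c ≤ d → a + c ≡ b + d → a ≡ b × c ≡ d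
+-≤-≡-split {a} {b} {c} {d} a≤b c≤d e = a≡b , +-cancelˡ-≡ b c d (trans (cong (_+ c) (sym a≡b)) e)
  where
  a≡b : a ≡ b
  a≡b = ≤-antisym a≤b (+-cancelʳ-≤ d b a (subst (_≤ a + d) e (+-monoʳ-≤ a c≤d)))

sum≡0⇒≈ₚ[] : ∀ Q → sum Q ≡ 0 → Q ≈ₚ []
sum≡0⇒≈ₚ[] []      e k       = refl
sum≡0⇒≈ₚ[] (y ∷ Q) e zero    = m+n≡0⇒m≡0 y e
sum≡0⇒≈ₚ[] (y ∷ Q) e (suc k) = sum≡0⇒≈ₚ[] Q (m+n≡0⇒n≡0 y e) k

sum-≡⇒≈ₚ : ∀ P Q → (∀ k → part P k ≤ part Q k) → sum P ≡ sum Q → P ≈ₚ Q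
sum-≡⇒≈ₚ []      Q       P≤Q e k = sym (sum≡0⇒≈ₚ[] Q (sym e) k)
sum-≡⇒≈ₚ (x ∷ P) []      P≤Q e k = sum≡0⇒≈ₚ[] (x ∷ P) e k
sum-≡⇒≈ₚ (x ∷ P) (y ∷ Q) P≤Q e k
  with +-≤-≡-split (P≤Q 0) (sum-mono P Q (P≤Q ∘ suc)) e | k
... | x≡y , _  | zero  = x≡y
... | _ , sums | suc k = sum-≡⇒≈ₚ P Q (P≤Q ∘ suc) sums k

extendsAt-suc : ∀ x P P′ Q r → P′ ≈ₚ (x ∷ P) → ExtendsAt Q P r → ExtendsAt (x ∷ Q) P′ (suc r)
extendsAt-suc x P P′ Q r P′≈ (extends Qr Qk) = extends (trans Qr (cong suc (sym (P′≈ (suc r))))) others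
  where
  others : ∀ k → k ≢ suc r → part (x ∷ Q) k ≡ part P′ k
  others zero    _   = sym (P′≈ 0)
  others (suc k) k≢r = trans (Qk k (k≢r ∘ cong suc)) (sym (P′≈ (suc k)))

[]≈ₚ0∷[] : [] ≈ₚ (0 ∷ [])
[]≈ₚ0∷[] zero    = refl
[]≈ₚ0∷[] (suc k) = refl

extendsAt-head : ∀ x y P P′ Q → P′ ≈ₚ (x ∷ P) → suc x ≡ y → P ≈ₚ Q → ExtendsAt (y ∷ Q) P′ 0
extendsAt-head x y P P′ Q P′≈ x<y P≈Q = extends (trans (sym x<y) (cong suc (sym (P′≈ 0)))) others
  where
  others : ∀ k → k ≢ 0 → part (y ∷ Q) k ≡ part P′ k
  others zero    k≢0 = contradiction refl k≢0
  others (suc k) _   = sym (trans (P′≈ (suc k)) (P≈Q k))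

part≤∧sum≡suc⇒ExtendsAt : ∀ P Q → (∀ k → part P k ≤ part Q k) → sum Q ≡ suc (sum P) →
  Σ ℕ (ExtendsAt Q P)
part≤∧sum≡suc⇒ExtendsAt []      (zero ∷ Q)  _   e with part≤∧sum≡suc⇒ExtendsAt [] Q (λ _ → z≤n) e
... | r , ext = suc r , extendsAt-suc 0 [] [] Q r []≈ₚ0∷[] ext
part≤∧sum≡suc⇒ExtendsAt []      (suc y ∷ Q) _   e = 0 , extendsAt-head 0 (suc y) [] [] Q []≈ₚ0∷[]
  (cong suc (sym (m+n≡0⇒m≡0 y (suc-injective e))))
  (λ k → sym (sum≡0⇒≈ₚ[] Q (m+n≡0⇒n≡0 y (suc-injective e)) k))
part≤∧sum≡suc⇒ExtendsAt (x ∷ P) (y ∷ Q) P≤Q e with x ≟ y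
... | yes refl with part≤∧sum≡suc⇒ExtendsAt P Q (P≤Q ∘ suc) (+-cancelˡ-≡ x _ _ (trans e (sym (+-suc x (sum P)))))
...   | r , ext = suc r , extendsAt-suc x P (x ∷ P) Q r (λ _ → refl) ext
part≤∧sum≡suc⇒ExtendsAt (x ∷ P) (y ∷ Q) P≤Q e | no x≢y
  with +-≤-≡-split (≤∧≢⇒< (P≤Q 0) x≢y) (sum-mono P Q (P≤Q ∘ suc)) (sym e)
... | x<y , sums = 0 , extendsAt-head x y P (x ∷ P) Q (λ _ → refl) x<y (sum-≡⇒≈ₚ P Q (P≤Q ∘ suc) sums)

⊲⇒ExtendsAt : ∀ ν μ → ν ⊲ μ → Σ ℕ (ExtendsAt μ ν)
⊲⇒ExtendsAt ν μ (ν⊆μ , size) = part≤∧sum≡suc⇒ExtendsAt ν μ (⊆P⇒part≤ ν μ ν⊆μ) size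

IsPartition-tail : ∀ {x xs} → IsPartition (x ∷ xs) → IsPartition xs
IsPartition-tail (dec , pos) = Linked.tail dec , All.tail pos

part-antitone : ∀ {xs} → IsPartition xs → ∀ {i j} → i ≤ j → part xs j ≤ part xs i
part-antitone {[]}     _ _ = z≤n
part-antitone {x ∷ xs} _ {j = zero}  z≤n = ≤-refl
part-antitone {x ∷ xs} p {j = suc j} z≤n =
  ≤-trans (part-antitone (IsPartition-tail p) {0} {j} z≤n) (second≤first xs (proj₁ p))
  where
  second≤first : ∀ xs → Linked (λ a b → b ≤ a) (x ∷ xs) → part xs 0 ≤ x
  second≤first []      _         = z≤n
  second≤first (_ ∷ _) (y≤x ∷ _) = y≤x
part-antitone {x ∷ xs} p (s≤s i≤j) = part-antitone (IsPartition-tail p) i≤j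

trim-partition : ∀ {xs} → IsPartition xs → trim xs ≡ xs
trim-partition = trim-positive ∘ proj₂

≈ₚ-partition⇒≡ : ∀ xs ys → IsPartition ys → xs ≈ₚ ys → trim xs ≡ xs → xs ≡ ys
≈ₚ-partition⇒≡ xs ys pys xs≈ys trimmed =
  trans (sym trimmed) (trans (trim-cong xs ys xs≈ys) (trim-partition pys))

-- Descent blocks and horizontal strips

Joins : Step → Step → Set
Joins s u = T (joins s u)

joins-deletions : ∀ {r c r′ c′} → r ≤ r′ → c′ < c → Joins (false , r , c) (false , r′ , c′)
joins-deletions r≤r′ c′<c =
  subst T (sym (∨-identityʳ _)) (Equivalence.from T-∧ (≤⇒≤ᵇ r≤r′ , <⇒<ᵇ c′<c))

joins-additions : ∀ {r c r′ c′} → r′ ≤ r → c < c′ → Joins (true , r , c) (true , r′ , c′)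
joins-additions r′≤r c<c′ =
  subst T (sym (∨-identityʳ _)) (Equivalence.from T-∧ (≤⇒≤ᵇ r′≤r , <⇒<ᵇ c<c′))

joins-deletions⁻¹ : ∀ {r c r′ c′} → Joins (false , r , c) (false , r′ , c′) → r ≤ r′ × c′ < c
joins-deletions⁻¹ j with Equivalence.to T-∧ (subst T (∨-identityʳ _) j)
... | r≤r′ , c′<c = ≤ᵇ⇒≤ _ _ r≤r′ , <ᵇ⇒< _ _ c′<c

joins-additions⁻¹ : ∀ {r c r′ c′} → Joins (true , r , c) (true , r′ , c′) → r′ ≤ r × c < c′
joins-additions⁻¹ j with Equivalence.to T-∧ (subst T (∨-identityʳ _) j)
... | r′≤r , c<c′ = ≤ᵇ⇒≤ _ _ r′≤r , <ᵇ⇒< _ _ c<c′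

strip-row-unique : ∀ ν κ → HorizontalStrip ν κ → ∀ {i i′ c} →
  InStrip ν κ i c → InStrip ν κ i′ c → i ≡ i′
strip-row-unique ν κ strip (κi≤c , c<νi) (κi′≤c , c<νi′) =
  strip _ _ _ (c<νi , ≤⇒≯ κi≤c) (c<νi′ , ≤⇒≯ κi′≤c)

strip-leftward-descends : ∀ ν κ → IsPartition ν → HorizontalStrip ν κ → ∀ {r c r′ c′} →
  InStrip ν κ r c → InStrip ν κ r′ c′ → c′ < c → r ≤ r′
strip-leftward-descends ν κ pν strip {r} {c} {r′} {c′} box@(_ , c<νr) (κr′≤c′ , _) c′<c
  with r ≤? r′
... | yes r≤r′ = r≤r′
... | no r≰r′  = contradiction (strip-row-unique ν κ strip below box) (<⇒≢ (≰⇒> r≰r′))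
  where
  below : InStrip ν κ r′ c
  below = ≤-trans κr′≤c′ (<⇒≤ c′<c) , <-≤-trans c<νr (part-antitone pν (<⇒≤ (≰⇒> r≰r′)))

-- Sweeping a horizontal strip column by column

clamp : ℕ → ℕ → ℕ → ℕ
clamp lo hi t = lo ⊔ (hi ⊓ t)

clamp-top : ∀ {lo hi t} → lo ≤ hi → hi ≤ t → clamp lo hi t ≡ hi
clamp-top {lo} {hi} {t} lo≤hi hi≤t rewrite m≤n⇒m⊓n≡m hi≤t = m≤n⇒m⊔n≡n lo≤hi

clamp-zero : ∀ lo hi → clamp lo hi 0 ≡ lo
clamp-zero lo hi rewrite ⊓-zeroʳ hi = ⊔-identityʳ lo

clamp-mid : ∀ {lo hi t} → lo ≤ t → t ≤ hi → clamp lo hi t ≡ t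
clamp-mid {lo} {hi} {t} lo≤t t≤hi rewrite m≥n⇒m⊓n≡n t≤hi = m≤n⇒m⊔n≡n lo≤t

lo≤clamp : ∀ lo hi t → lo ≤ clamp lo hi t
lo≤clamp lo hi t = m≤m⊔n lo (hi ⊓ t)

clamp-suc : ∀ {lo hi} t → lo ≤ hi → ¬ (lo ≤ t × t < hi) → clamp lo hi t ≡ clamp lo hi (suc t)
clamp-suc {lo} {hi} t lo≤hi outside with lo ≤? t
... | no lo≰t = trans (m≥n⇒m⊔n≡m (≤-trans (m⊓n≤n hi t) (<⇒≤ (≰⇒> lo≰t))))
                      (sym (m≥n⇒m⊔n≡m (≤-trans (m⊓n≤n hi (suc t)) (≰⇒> lo≰t))))
... | yes lo≤t with hi ≤? t
...   | yes hi≤t = trans (clamp-top lo≤hi hi≤t) (sym (clamp-top lo≤hi (m≤n⇒m≤1+n hi≤t)))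
...   | no hi≰t  = contradiction (lo≤t , ≰⇒> hi≰t) outside

clamp-suc-≡ : ∀ {lo hi t} → lo ≤ t → clamp lo hi (suc t) ≡ suc t → t < hi
clamp-suc-≡ {lo} {hi} {t} lo≤t clamped with hi ≤? t
... | no hi≰t  = ≰⇒> hi≰t
... | yes hi≤t = contradiction (≤-reflexive (sym clamped))
                   (<⇒≱ (s≤s (⊔-lub lo≤t (≤-trans (m⊓n≤m hi (suc t)) hi≤t))))

-- The rows of ν with the boxes of ν/κ in columns ≥ t removed.
cut : List ℕ → List ℕ → ℕ → ℕ → ℕ
cut ν κ t r = clamp (part κ r) (part ν r) t

IsCut : List ℕ → List ℕ → ℕ → List ℕ → Set
IsCut ν κ t X = ∀ r → part X r ≡ cut ν κ t r

module Sweep (ν κ : List ℕ) (κ≤ν : ∀ r → part κ r ≤ part ν r) (strip : HorizontalStrip ν κ) where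

  cut-zero : ∀ r → cut ν κ 0 r ≡ part κ r
  cut-zero r = clamp-zero (part κ r) (part ν r)

  cut-top : ∀ {t} → (∀ r → part ν r ≤ t) → ∀ r → cut ν κ t r ≡ part ν r
  cut-top ν≤t r = clamp-top (κ≤ν r) (ν≤t r)

  cut-skip : ∀ {t r} → ¬ InStrip ν κ r t → cut ν κ t r ≡ cut ν κ (suc t) r
  cut-skip {t} {r} = clamp-suc t (κ≤ν r)

  cut-at : ∀ {i t} → InStrip ν κ i t → cut ν κ t i ≡ t
  cut-at (κi≤t , t<νi) = clamp-mid κi≤t (<⇒≤ t<νi)

  cut-at-suc : ∀ {i t} → InStrip ν κ i t → cut ν κ (suc t) i ≡ suc t
  cut-at-suc (κi≤t , t<νi) = clamp-mid (m≤n⇒m≤1+n κi≤t) t<νi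

  cut-other : ∀ {i t r} → InStrip ν κ i t → r ≢ i → cut ν κ t r ≡ cut ν κ (suc t) r
  cut-other box r≢i = cut-skip (r≢i ∘ λ box′ → strip-row-unique ν κ strip box′ box)

  cut-skip-all : ∀ {t} X → (∀ r → ¬ InStrip ν κ r t) → IsCut ν κ t X → IsCut ν κ (suc t) X
  cut-skip-all X empty X≈ r = trans (X≈ r) (cut-skip (empty r))

  cut-skip-all⁻¹ : ∀ {t} X → (∀ r → ¬ InStrip ν κ r t) → IsCut ν κ (suc t) X → IsCut ν κ t X
  cut-skip-all⁻¹ X empty X≈ r = trans (X≈ r) (sym (cut-skip (empty r)))

  cut-extends : ∀ {i t} X Y → InStrip ν κ i t →
    IsCut ν κ (suc t) X → IsCut ν κ t Y → ExtendsAt X Y i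
  cut-extends {i} X Y box X≈ Y≈ =
    extends (trans (X≈ i) (trans (cut-at-suc box) (cong suc (sym (trans (Y≈ i) (cut-at box))))))
            (λ k k≢i → trans (X≈ k) (trans (sym (cut-other box k≢i)) (sym (Y≈ k))))

  setAt-cut : ∀ {i} X v → cut ν κ v i ≡ v →
    (∀ r → r ≢ i → part X r ≡ cut ν κ v r) → IsCut ν κ v (setAt i v X)
  setAt-cut {i} X v vi X≈ r with r ≟ i
  ... | yes refl = trans (part-setAt-≡ i v X) (sym vi)
  ... | no r≢i   = trans (part-setAt-≢ i v X r r≢i) (X≈ r r≢i)

  setAt-cut-down : ∀ {i t} X → InStrip ν κ i t → IsCut ν κ (suc t) X → IsCut ν κ t (setAt i t X)
  setAt-cut-down X box X≈ = setAt-cut X _ (cut-at box)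
    (λ r r≢i → trans (X≈ r) (sym (cut-other box r≢i)))

  setAt-cut-up : ∀ {i t} X → InStrip ν κ i t → IsCut ν κ t X → IsCut ν κ (suc t) (setAt i (suc t) X)
  setAt-cut-up X box X≈ = setAt-cut X _ (cut-at-suc box)
    (λ r r≢i → trans (X≈ r) (cut-other box r≢i))

final : List ℕ → List (List ℕ) → List ℕ
final x []       = x
final x (y ∷ ys) = final y ys

interval : ℕ → ℕ → List ℕ
interval a zero    = []
interval a (suc n) = a ∷ interval (suc a) n

upTo≡interval : ∀ n → upTo n ≡ interval 0 n
upTo≡interval n = go 0 n (λ _ → refl)
  where
  go : ∀ a n {f : ℕ → ℕ} → (∀ k → f k ≡ a + k) → applyUpTo f n ≡ interval a n
  go a zero    f≡ = refl
  go a (suc n) f≡ = cong₂ _∷_ (trans (f≡ 0) (+-identityʳ a))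
                            (go (suc a) n (λ k → trans (f≡ (suc k)) (+-suc a k)))

linked-∷ : ∀ {h xs} → All (Joins h) xs → Linked Joins xs → Linked Joins (h ∷ xs)
linked-∷ []      _ = [-]
linked-∷ (j ∷ _) l = j ∷ l

data LeftwardDeletions : ℕ → List ℕ → List (List ℕ) → Set where
  done   : ∀ {t x} → LeftwardDeletions t x []
  delete : ∀ {t x y D} r → ExtendsAt x y r → part y r < t →
           LeftwardDeletions (part y r) y D → LeftwardDeletions t x (y ∷ D)

data RightwardAdditions : ℕ → List ℕ → List (List ℕ) → Set where
  done : ∀ {a x} → RightwardAdditions a x []
  add  : ∀ {a x y A} r → ExtendsAt y x r → a ≤ part x r →
         RightwardAdditions (suc (part x r)) y A → RightwardAdditions a x (y ∷ A)

leftward-shrinks : ∀ {t x D} → LeftwardDeletions t x D → ∀ k → part (final x D) k ≤ part x k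
leftward-shrinks done              k = ≤-refl
leftward-shrinks (delete r ext _ D) k = ≤-trans (leftward-shrinks D k) (ExtendsAt⇒part≤ ext k)

rightward-grows : ∀ {a x A} → RightwardAdditions a x A → ∀ k → part x k ≤ part (final x A) k
rightward-grows done            k = ≤-refl
rightward-grows (add r ext _ A) k = ≤-trans (ExtendsAt⇒part≤ ext k) (rightward-grows A k)

leftward-keeps-long-rows : ∀ {t x D} → LeftwardDeletions t x D →
  ∀ i → t < part x i → part (final x D) i ≡ part x i
leftward-keeps-long-rows done i _ = refl
leftward-keeps-long-rows (delete r (extends xr xk) yr<t D) i t<xi with i ≟ r
... | yes refl = contradiction (<-≤-trans yr<t (≤-pred (subst (_ <_) xr t<xi))) (<-irrefl refl)
... | no i≢r   = trans (leftward-keeps-long-rows D i (<-≤-trans yr<t (<⇒≤ (subst (_ <_) (xk i i≢r) t<xi))))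
                       (sym (xk i i≢r))

rightward-keeps-short-rows : ∀ {a x A} → RightwardAdditions a x A →
  ∀ i → part x i < a → part (final x A) i ≡ part x i
rightward-keeps-short-rows done i _ = refl
rightward-keeps-short-rows (add r (extends yr yk) a≤xr A) i xi<a with i ≟ r
... | yes refl = contradiction (<-≤-trans xi<a a≤xr) (<-irrefl refl)
... | no i≢r   = trans (rightward-keeps-short-rows A i
                          (subst (_< suc _) (sym (yk i i≢r)) (s≤s (≤-trans (<⇒≤ xi<a) a≤xr))))
                       (yk i i≢r)

leftward-strip : ∀ {t x D} → LeftwardDeletions t x D → HorizontalStrip x (final x D)
leftward-strip done _ _ _ (inside , outside) _ = contradiction inside outside
leftward-strip {x = x} (delete {y = y} {D} r (extends xr xk) _ rest) i₁ i₂ j box₁ box₂ =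
  same-row (split i₁ box₁) (split i₂ box₂)
  where
  κ = final y D
  Position : ℕ → Set
  Position i = (j < part y r × InSkew y κ (i , j)) ⊎ (i ≡ r × j ≡ part y r)
  split : ∀ i → InSkew x κ (i , j) → Position i
  split i (j<xi , j∉κ) with i ≟ r | j <? part y r
  ... | yes refl | yes j<yr = inj₁ (j<yr , j<yr , j∉κ)
  ... | yes refl | no  j≮yr = inj₂ (refl , ≤-antisym (≤-pred (subst (j <_) xr j<xi)) (≮⇒≥ j≮yr))
  ... | no  i≢r  | yes j<yr = inj₁ (j<yr , subst (j <_) (xk i i≢r) j<xi , j∉κ)
  ... | no  i≢r  | no  j≮yr = contradiction
        (subst (j <_) (sym (leftward-keeps-long-rows rest i (≤-<-trans (≮⇒≥ j≮yr) j<yi))) j<yi) j∉κ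
    where
    j<yi = subst (j <_) (xk i i≢r) j<xi
  same-row : Position i₁ → Position i₂ → i₁ ≡ i₂
  same-row (inj₁ (_ , b₁))  (inj₁ (_ , b₂))  = leftward-strip rest i₁ i₂ j b₁ b₂
  same-row (inj₂ (i₁≡r , _)) (inj₂ (i₂≡r , _)) = trans i₁≡r (sym i₂≡r)
  same-row (inj₁ (j< , _))  (inj₂ (_ , j≡))  = contradiction j≡ (<⇒≢ j<)
  same-row (inj₂ (_ , j≡))  (inj₁ (j< , _))  = contradiction j≡ (<⇒≢ j<)

rightward-strip : ∀ {a x A} → RightwardAdditions a x A → HorizontalStrip (final x A) x
rightward-strip done _ _ _ (inside , outside) _ = contradiction inside outside
rightward-strip {x = x} (add {y = y} {A} r (extends yr yk) _ rest) i₁ i₂ j box₁ box₂ =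
  same-row (split i₁ box₁) (split i₂ box₂)
  where
  μ = final y A
  Position : ℕ → Set
  Position i = (part x r < j × InSkew μ y (i , j)) ⊎ (i ≡ r × j ≡ part x r)
  split : ∀ i → InSkew μ x (i , j) → Position i
  split i (j<μi , j∉x) with i ≟ r | part x r <? j
  ... | yes refl | yes xr<j =
        inj₁ (xr<j , j<μi , λ j<yr → contradiction (subst (j <_) yr j<yr) (<⇒≱ (s≤s xr<j)))
  ... | yes refl | no  xr≮j = inj₂ (refl , ≤-antisym (≮⇒≥ xr≮j) (≮⇒≥ j∉x))
  ... | no  i≢r  | yes xr<j = inj₁ (xr<j , j<μi , j∉x ∘ subst (j <_) (yk i i≢r))
  ... | no  i≢r  | no  xr≮j = contradiction (subst (j <_) μi≡xi j<μi) j∉x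
    where
    μi≡xi : part μ i ≡ part x i
    μi≡xi = trans (rightward-keeps-short-rows rest i
                    (subst (_< suc (part x r)) (sym (yk i i≢r)) (s≤s (≤-trans (≮⇒≥ j∉x) (≮⇒≥ xr≮j)))))
                  (yk i i≢r)
  same-row : Position i₁ → Position i₂ → i₁ ≡ i₂
  same-row (inj₁ (_ , b₁))  (inj₁ (_ , b₂))  = rightward-strip rest i₁ i₂ j b₁ b₂
  same-row (inj₂ (i₁≡r , _)) (inj₂ (i₂≡r , _)) = trans i₁≡r (sym i₂≡r)
  same-row (inj₁ (<j , _))  (inj₂ (_ , j≡))  = contradiction (sym j≡) (<⇒≢ <j)
  same-row (inj₂ (_ , j≡))  (inj₁ (<j , _))  = contradiction (sym j≡) (<⇒≢ <j)

setAt-determined : ∀ x y r v → (∀ k → k ≢ r → part y k ≡ part x k) → part y r ≡ v →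
  IsPartition y → setAt r v x ≡ y
setAt-determined x y r v others yr py = ≈ₚ-partition⇒≡ (setAt r v x) y py rows (trim-setAt r v x)
  where
  rows : setAt r v x ≈ₚ y
  rows k with k ≟ r
  ... | yes refl = trans (part-setAt-≡ r v x) (sym yr)
  ... | no k≢r   = trans (part-setAt-≢ r v x k k≢r) (sym (others k k≢r))

module RemovalSweep (ν κ : List ℕ) (pν : IsPartition ν) (pκ : IsPartition κ)
                    (κ≤ν : ∀ r → part κ r ≤ part ν r) (strip : HorizontalStrip ν κ) where
  open Sweep ν κ κ≤ν strip

  DeletionLeftOf : ℕ → Step → Set
  DeletionLeftOf t s = Σ ℕ λ r → Σ ℕ λ c → s ≡ (false , r , c) × InStrip ν κ r c × c < t

  record Removal (t : ℕ) (cur : List ℕ) (L : List (List ℕ)) : Set where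
    field
      ends    : final cur L ≡ κ
      length≡ : length L + sum κ ≡ sum cur
      left    : All (DeletionLeftOf t) (stepsOf (cur ∷ L))
      linked  : Linked Joins (stepsOf (cur ∷ L))

  leftOf-suc : ∀ {t s} → DeletionLeftOf t s → DeletionLeftOf (suc t) s
  leftOf-suc (r , c , s≡ , box , c<t) = r , c , s≡ , box , m≤n⇒m≤1+n c<t

  joins-leftOf : ∀ {i t s} → InStrip ν κ i t → DeletionLeftOf t s → Joins (false , i , t) s
  joins-leftOf box (r , c , refl , box′ , c<t) =
    joins-deletions (strip-leftward-descends ν κ pν strip box box′ c<t) c<t

  removal : ∀ t cur → trim cur ≡ cur → IsCut ν κ t cur →
    Removal t cur (removeCols ν κ (downFrom t) cur)
  removal zero cur trimmed cur≈ = record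
    { ends = cur≡κ ; length≡ = cong sum (sym cur≡κ) ; left = [] ; linked = [] }
    where
    cur≡κ : cur ≡ κ
    cur≡κ = ≈ₚ-partition⇒≡ cur κ pκ (λ r → trans (cur≈ r) (cut-zero r)) trimmed
  removal (suc t) cur trimmed cur≈ with findRow ν κ t in found
  ... | nothing = record
    { ends    = Removal.ends rest
    ; length≡ = Removal.length≡ rest
    ; left    = All.map leftOf-suc (Removal.left rest)
    ; linked  = Removal.linked rest }
    where
    rest : Removal t cur (removeCols ν κ (downFrom t) cur)
    rest = removal t cur trimmed (cut-skip-all⁻¹ cur (findRow-nothing ν κ t found) cur≈)
  ... | just i = record
    { ends    = Removal.ends rest
    ; length≡ = trans (cong suc (Removal.length≡ rest)) (sym (ExtendsAt-size ext))
    ; left    = subst (DeletionLeftOf (suc t)) (sym step≡) (i , t , refl , box , n<1+n t)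
                ∷ All.map leftOf-suc (Removal.left rest)
    ; linked  = subst (λ s → Linked Joins (s ∷ stepsOf (cur′ ∷ L′))) (sym step≡)
                  (linked-∷ (All.map (joins-leftOf box) (Removal.left rest)) (Removal.linked rest)) }
    where
    box : InStrip ν κ i t
    box = findRow-just ν κ t i found
    cur′ : List ℕ
    cur′ = setAt i t cur
    L′ : List (List ℕ)
    L′ = removeCols ν κ (downFrom t) cur′
    cur′≈ : IsCut ν κ t cur′
    cur′≈ = setAt-cut-down cur box cur≈
    ext : ExtendsAt cur cur′ i
    ext = cut-extends cur cur′ box cur≈ cur′≈
    rest : Removal t cur′ L′
    rest = removal t cur′ (trim-setAt i t cur) cur′≈
    step≡ : step cur cur′ ≡ (false , i , t)
    step≡ = trans (step-deletion ext) (cong (λ c → false , i , c) (part-setAt-≡ i t cur))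

  deleted-box : ∀ {t cur y r D} → IsCut ν κ (suc t) cur → ExtendsAt cur y r → part y r ≡ t →
    LeftwardDeletions (part y r) y D → final y D ≡ κ → InStrip ν κ r t
  deleted-box {t} {cur} {y} {r} cur≈ (extends cur-r _) yr≡t rest ends = κr≤t , clamp-suc-≡ κr≤t (begin
    cut ν κ (suc t) r ≡⟨ cur≈ r ⟨
    part cur r        ≡⟨ cur-r ⟩
    suc (part y r)    ≡⟨ cong suc yr≡t ⟩
    suc t             ∎)
    where
    open ≡-Reasoning
    κr≤t : part κ r ≤ t
    κr≤t = subst₂ (λ z w → part z r ≤ w) ends yr≡t (leftward-shrinks rest r)

  first-deletion-skipped : ∀ {t cur y r D} → IsCut ν κ (suc t) cur → findRow ν κ t ≡ nothing →
    ExtendsAt cur y r → part y r < suc t → LeftwardDeletions (part y r) y D → final y D ≡ κ → part y r < t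
  first-deletion-skipped cur≈ found ext yr≤t rest ends with m≤n⇒m<n∨m≡n (≤-pred yr≤t)
  ... | inj₁ yr<t = yr<t
  ... | inj₂ yr≡t = contradiction (deleted-box cur≈ ext yr≡t rest ends) (findRow-nothing ν κ _ found _)

  first-deletion-found : ∀ {t cur y r D i} → IsCut ν κ (suc t) cur → findRow ν κ t ≡ just i →
    ExtendsAt cur y r → part y r < suc t → LeftwardDeletions (part y r) y D → final y D ≡ κ →
    IsPartition y → part y r ≡ t × setAt i t cur ≡ y
  first-deletion-found {t} {cur} {y} {r} {D} {i} cur≈ found ext yr≤t rest ends py = yr≡t , y≡
    where
    box : InStrip ν κ i t
    box = findRow-just ν κ t i found
    yr≡t : part y r ≡ t
    yr≡t with m≤n⇒m<n∨m≡n (≤-pred yr≤t)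
    ... | inj₂ yr≡t = yr≡t
    ... | inj₁ yr<t = contradiction (subst (_≤ t) κi≡ (proj₁ box)) 1+n≰n
      where
      curi≡ : part cur i ≡ suc t
      curi≡ = trans (cur≈ i) (cut-at-suc box)
      κi≡ : part κ i ≡ suc t
      κi≡ = trans (cong (λ z → part z i) (sym ends))
              (trans (leftward-keeps-long-rows (delete r ext yr<t rest) i (subst (t <_) (sym curi≡) ≤-refl))
                     curi≡)
    r≡i : r ≡ i
    r≡i = strip-row-unique ν κ strip (deleted-box cur≈ ext yr≡t rest ends) box
    y≡ : setAt i t cur ≡ y
    y≡ = setAt-determined cur y i t (λ k k≢i → sym (ExtendsAt.others ext k (λ k≡r → k≢i (trans k≡r r≡i))))
           (trans (cong (part y) (sym r≡i)) yr≡t) py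

  removal-unique : ∀ t cur D → LeftwardDeletions t cur D → IsCut ν κ t cur → final cur D ≡ κ →
    All IsPartition D → removeCols ν κ (downFrom t) cur ≡ D
  removal-unique zero    cur []      _                      _    _    _ = refl
  removal-unique zero    cur (_ ∷ _) (delete _ _ () _)      _    _    _
  removal-unique (suc t) cur D       run                    cur≈ ends pD with findRow ν κ t in found
  removal-unique (suc t) cur []      done                   cur≈ ends pD | nothing =
    removal-unique t cur [] done (cut-skip-all⁻¹ cur (findRow-nothing ν κ t found) cur≈) ends pD
  removal-unique (suc t) cur (y ∷ D) (delete r ext yr≤t rest) cur≈ ends pD | nothing =
    removal-unique t cur (y ∷ D) (delete r ext (first-deletion-skipped cur≈ found ext yr≤t rest ends) rest)
      (cut-skip-all⁻¹ cur (findRow-nothing ν κ t found) cur≈) ends pD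
  removal-unique (suc t) cur []      done                   cur≈ ends pD | just i =
    contradiction (subst (_≤ t) κi≡ (proj₁ box)) 1+n≰n
    where
    box : InStrip ν κ i t
    box = findRow-just ν κ t i found
    κi≡ : part κ i ≡ suc t
    κi≡ = trans (cong (λ z → part z i) (sym ends)) (trans (cur≈ i) (cut-at-suc box))
  removal-unique (suc t) cur (y ∷ D) (delete r ext yr≤t rest) cur≈ ends (py ∷ pD) | just i
    with first-deletion-found cur≈ found ext yr≤t rest ends py
  ... | yr≡t , y≡ = cong₂ _∷_ y≡ (trans (cong (removeCols ν κ (downFrom t)) y≡)
      (removal-unique t y D (subst (λ c → LeftwardDeletions c y D) yr≡t rest)
        (subst (IsCut ν κ t) y≡ (setAt-cut-down cur (findRow-just ν κ t i found) cur≈)) ends pD))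

  ν-cut : IsCut ν κ (part ν 0) ν
  ν-cut r = sym (cut-top (λ r → part-antitone pν z≤n) r)

  removeSeq≡removeCols : removeSeq ν κ ≡ removeCols ν κ (downFrom (part ν 0)) ν
  removeSeq≡removeCols = cong (λ cs → removeCols ν κ cs ν) (reverse-upTo (part ν 0))

  removeSeq-removal : Removal (part ν 0) ν (removeSeq ν κ)
  removeSeq-removal = subst (Removal (part ν 0) ν) (sym removeSeq≡removeCols)
    (removal (part ν 0) ν (trim-partition pν) ν-cut)

  removeSeq-unique : ∀ D → LeftwardDeletions (part ν 0) ν D → final ν D ≡ κ → All IsPartition D →
    removeSeq ν κ ≡ D
  removeSeq-unique D run ends pD =
    trans removeSeq≡removeCols (removal-unique (part ν 0) ν D run ν-cut ends pD)

module AdditionSweep (μ κ : List ℕ) (pμ : IsPartition μ)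
                     (κ≤μ : ∀ r → part κ r ≤ part μ r) (strip : HorizontalStrip μ κ) where
  open Sweep μ κ κ≤μ strip

  AdditionFrom : ℕ → Step → Set
  AdditionFrom a s = Σ ℕ λ r → Σ ℕ λ c → s ≡ (true , r , c) × InStrip μ κ r c × a ≤ c

  record Addition (a : ℕ) (cur : List ℕ) (L : List (List ℕ)) : Set where
    field
      ends    : final cur L ≡ μ
      length≡ : sum cur + length L ≡ sum μ
      right   : All (AdditionFrom a) (stepsOf (cur ∷ L))
      linked  : Linked Joins (stepsOf (cur ∷ L))

  from-suc : ∀ {a s} → AdditionFrom (suc a) s → AdditionFrom a s
  from-suc (r , c , s≡ , box , a<c) = r , c , s≡ , box , <⇒≤ a<c

  joins-from : ∀ {i a s} → InStrip μ κ i a → AdditionFrom (suc a) s → Joins (true , i , a) s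
  joins-from box (r , c , refl , box′ , a<c) =
    joins-additions (strip-leftward-descends μ κ pμ strip box′ box a<c) a<c

  addition : ∀ n a cur → trim cur ≡ cur → IsCut μ κ a cur → (∀ r → part μ r ≤ a + n) →
    Addition a cur (addCols μ κ (interval a n) cur)
  addition zero a cur trimmed cur≈ μ≤a = record
    { ends = cur≡μ ; length≡ = trans (+-identityʳ _) (cong sum cur≡μ) ; right = [] ; linked = [] }
    where
    cur≡μ : cur ≡ μ
    cur≡μ = ≈ₚ-partition⇒≡ cur μ pμ
      (λ r → trans (cur≈ r) (cut-top (λ r → subst (part μ r ≤_) (+-identityʳ a) (μ≤a r)) r)) trimmed
  addition (suc n) a cur trimmed cur≈ μ≤a with findRow μ κ a in found
  ... | nothing = record
    { ends    = Addition.ends rest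
    ; length≡ = Addition.length≡ rest
    ; right   = All.map from-suc (Addition.right rest)
    ; linked  = Addition.linked rest }
    where
    rest : Addition (suc a) cur (addCols μ κ (interval (suc a) n) cur)
    rest = addition n (suc a) cur trimmed (cut-skip-all cur (findRow-nothing μ κ a found) cur≈)
                    (λ r → subst (part μ r ≤_) (+-suc a n) (μ≤a r))
  ... | just i = record
    { ends    = Addition.ends rest
    ; length≡ = trans (+-suc (sum cur) (length L′))
                  (trans (cong (_+ length L′) (sym (ExtendsAt-size ext))) (Addition.length≡ rest))
    ; right   = subst (AdditionFrom a) (sym step≡) (i , a , refl , box , ≤-refl)
                ∷ All.map from-suc (Addition.right rest)
    ; linked  = subst (λ s → Linked Joins (s ∷ stepsOf (cur′ ∷ L′)))
                  (sym step≡) (linked-∷ (All.map (joins-from box) (Addition.right rest)) (Addition.linked rest)) }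
    where
    box : InStrip μ κ i a
    box = findRow-just μ κ a i found
    cur′ : List ℕ
    cur′ = setAt i (suc a) cur
    L′ : List (List ℕ)
    L′ = addCols μ κ (interval (suc a) n) cur′
    cur′≈ : IsCut μ κ (suc a) cur′
    cur′≈ = setAt-cut-up cur box cur≈
    ext : ExtendsAt cur′ cur i
    ext = cut-extends cur′ cur box cur′≈ cur≈
    rest : Addition (suc a) cur′ L′
    rest = addition n (suc a) cur′ (trim-setAt i (suc a) cur) cur′≈
                      (λ r → subst (part μ r ≤_) (+-suc a n) (μ≤a r))
    step≡ : step cur cur′ ≡ (true , i , a)
    step≡ = trans (step-addition ext) (cong (λ c → true , i , c) (trans (cur≈ i) (cut-at box)))

  added-box : ∀ {a y r A} cur → IsCut μ κ a cur → ExtendsAt y cur r → part cur r ≡ a →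
    RightwardAdditions (suc (part cur r)) y A → final y A ≡ μ → InStrip μ κ r a
  added-box {a} {y} {r} cur cur≈ (extends yr _) cr≡a rest ends =
      subst (part κ r ≤_) (trans (sym (cur≈ r)) cr≡a) (lo≤clamp _ _ a)
    , subst₂ _≤_ (trans yr (cong suc cr≡a)) (cong (λ z → part z r) ends) (rightward-grows rest r)

  first-addition-skipped : ∀ {a cur y r A} → IsCut μ κ a cur → findRow μ κ a ≡ nothing →
    ExtendsAt y cur r → a ≤ part cur r → RightwardAdditions (suc (part cur r)) y A → final y A ≡ μ →
    a < part cur r
  first-addition-skipped {cur = cur} cur≈ found ext a≤cr rest ends with m≤n⇒m<n∨m≡n a≤cr
  ... | inj₁ a<cr = a<cr
  ... | inj₂ a≡cr = contradiction (added-box cur cur≈ ext (sym a≡cr) rest ends) (findRow-nothing μ κ _ found _)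

  first-addition-found : ∀ {a cur y r A i} → IsCut μ κ a cur → findRow μ κ a ≡ just i →
    ExtendsAt y cur r → a ≤ part cur r → RightwardAdditions (suc (part cur r)) y A → final y A ≡ μ →
    IsPartition y → part cur r ≡ a × setAt i (suc a) cur ≡ y
  first-addition-found {a} {cur} {y} {r} {A} {i} cur≈ found ext a≤cr rest ends py = cr≡a , y≡
    where
    box : InStrip μ κ i a
    box = findRow-just μ κ a i found
    cr≡a : part cur r ≡ a
    cr≡a with m≤n⇒m<n∨m≡n a≤cr
    ... | inj₂ a≡cr = sym a≡cr
    ... | inj₁ a<cr = ⊥-elim (<-irrefl μi≡ (proj₂ box))
      where
      curi≡ : part cur i ≡ a
      curi≡ = trans (cur≈ i) (cut-at box)
      μi≡ : a ≡ part μ i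
      μi≡ = trans (sym curi≡) (trans (sym (rightward-keeps-short-rows (add r ext a<cr rest) i
                                              (subst (_< suc a) (sym curi≡) ≤-refl)))
                                     (cong (λ z → part z i) ends))
    r≡i : r ≡ i
    r≡i = strip-row-unique μ κ strip (added-box cur cur≈ ext cr≡a rest ends) box
    y≡ : setAt i (suc a) cur ≡ y
    y≡ = setAt-determined cur y i (suc a) (λ k k≢i → ExtendsAt.others ext k (λ k≡r → k≢i (trans k≡r r≡i)))
           (trans (cong (part y) (sym r≡i)) (trans (ExtendsAt.grown ext) (cong suc cr≡a))) py

  addition-unique : ∀ n a cur A → RightwardAdditions a cur A → IsCut μ κ a cur → final cur A ≡ μ →
    All IsPartition A → (∀ r → part μ r ≤ a + n) → addCols μ κ (interval a n) cur ≡ A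
  addition-unique zero a cur [] _ _ _ _ _ = refl
  addition-unique zero a cur (y ∷ A) (add r ext a≤cr rest) _ ends _ μ≤a =
    contradiction (begin
      suc (part cur r)   ≡⟨ ExtendsAt.grown ext ⟨
      part y r           ≤⟨ rightward-grows rest r ⟩
      part (final y A) r ≡⟨ cong (λ z → part z r) ends ⟩
      part μ r           ≤⟨ μ≤a r ⟩
      a + 0              ≡⟨ +-identityʳ a ⟩
      a                  ≤⟨ a≤cr ⟩
      part cur r         ∎) 1+n≰n
    where open ≤-Reasoning
  addition-unique (suc n) a cur A run cur≈ ends pA μ≤a with findRow μ κ a in found
  addition-unique (suc n) a cur [] done cur≈ ends pA μ≤a | nothing =
    addition-unique n (suc a) cur [] done (cut-skip-all cur (findRow-nothing μ κ a found) cur≈) ends pA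
      (λ r → subst (part μ r ≤_) (+-suc a n) (μ≤a r))
  addition-unique (suc n) a cur (y ∷ A) (add r ext a≤cr rest) cur≈ ends pA μ≤a | nothing =
    addition-unique n (suc a) cur (y ∷ A) (add r ext (first-addition-skipped cur≈ found ext a≤cr rest ends) rest)
      (cut-skip-all cur (findRow-nothing μ κ a found) cur≈) ends pA
      (λ r → subst (part μ r ≤_) (+-suc a n) (μ≤a r))
  addition-unique (suc n) a cur [] done cur≈ ends pA μ≤a | just i =
    ⊥-elim (<-irrefl (trans (sym (trans (cur≈ i) (cut-at box))) (cong (λ z → part z i) ends)) (proj₂ box))
    where
    box : InStrip μ κ i a
    box = findRow-just μ κ a i found
  addition-unique (suc n) a cur (y ∷ A) (add r ext a≤cr rest) cur≈ ends (py ∷ pA) μ≤a | just i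
    with first-addition-found cur≈ found ext a≤cr rest ends py
  ... | cr≡a , y≡ = cong₂ _∷_ y≡ (trans (cong (addCols μ κ (interval (suc a) n)) y≡)
      (addition-unique n (suc a) y A (subst (λ c → RightwardAdditions (suc c) y A) cr≡a rest)
        (subst (IsCut μ κ (suc a)) y≡ (setAt-cut-up cur (findRow-just μ κ a i found) cur≈)) ends pA
        (λ r → subst (part μ r ≤_) (+-suc a n) (μ≤a r))))

  κ-cut : IsCut μ κ 0 κ
  κ-cut r = sym (cut-zero r)

  μ-bounded : ∀ r → part μ r ≤ 0 + part μ 0
  μ-bounded r = part-antitone pμ z≤n

  addSeq≡addCols : addSeq κ μ ≡ addCols μ κ (interval 0 (part μ 0)) κ
  addSeq≡addCols = cong (λ cs → addCols μ κ cs κ) (upTo≡interval (part μ 0))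

  addSeq-addition : IsPartition κ → Addition 0 κ (addSeq κ μ)
  addSeq-addition pκ = subst (Addition 0 κ) (sym addSeq≡addCols)
    (addition (part μ 0) 0 κ (trim-partition pκ) κ-cut μ-bounded)

  addSeq-unique : ∀ A → RightwardAdditions 0 κ A → final κ A ≡ μ → All IsPartition A → addSeq κ μ ≡ A
  addSeq-unique A run ends pA =
    trans addSeq≡addCols (addition-unique (part μ 0) 0 κ A run κ-cut ends pA μ-bounded)

-- Standardization of one step

record StripStep (ν κ μ : List ℕ) : Set where
  field
    ν-partition : IsPartition ν
    κ-partition : IsPartition κ
    μ-partition : IsPartition μ
    κ≤ν         : ∀ r → part κ r ≤ part ν r
    κ≤μ         : ∀ r → part κ r ≤ part μ r
    ν/κ-strip   : HorizontalStrip ν κ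
    μ/κ-strip   : HorizontalStrip μ κ

segment : List ℕ → List ℕ → List ℕ → List (List ℕ)
segment ν κ μ = removeSeq ν κ ++ addSeq κ μ

final-++ : ∀ x A B → final x (A ++ B) ≡ final (final x A) B
final-++ x []      B = refl
final-++ x (y ∷ A) B = final-++ y A B

stepsOf-++ : ∀ x A B → stepsOf (x ∷ A ++ B) ≡ stepsOf (x ∷ A) ++ stepsOf (final x A ∷ B)
stepsOf-++ x []      B = refl
stepsOf-++ x (y ∷ A) B = cong (step x y ∷_) (stepsOf-++ y A B)

IsDeletion IsAddition : Step → Set
IsDeletion s = Σ Box λ b → s ≡ (false , b)
IsAddition s = Σ Box λ b → s ≡ (true , b)

linked-deletions-++-additions : ∀ xs ys → All IsDeletion xs → All IsAddition ys →
  Linked Joins xs → Linked Joins ys → Linked Joins (xs ++ ys)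
linked-deletions-++-additions []           ys _ _ _ lys = lys
linked-deletions-++-additions (_ ∷ [])     [] _ _ _ _   = [-]
linked-deletions-++-additions (_ ∷ [])     (_ ∷ _) ((_ , refl) ∷ _) ((_ , refl) ∷ _) _ lys = tt ∷ lys
linked-deletions-++-additions (_ ∷ x ∷ xs) ys (_ ∷ dxs) ays (j ∷ lxs) lys =
  j ∷ linked-deletions-++-additions (x ∷ xs) ys dxs ays lxs lys

module _ {ν κ μ : List ℕ} (s : StripStep ν κ μ) where
  open StripStep s
  private
    module R = RemovalSweep.Removal (RemovalSweep.removeSeq-removal ν κ ν-partition κ-partition κ≤ν ν/κ-strip)
    module A = AdditionSweep.Addition (AdditionSweep.addSeq-addition μ κ μ-partition κ≤μ μ/κ-strip κ-partition)

  segment-final : final ν (segment ν κ μ) ≡ μ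
  segment-final = begin
    final ν (removeSeq ν κ ++ addSeq κ μ)    ≡⟨ final-++ ν (removeSeq ν κ) (addSeq κ μ) ⟩
    final (final ν (removeSeq ν κ)) (addSeq κ μ) ≡⟨ cong (λ x → final x (addSeq κ μ)) R.ends ⟩
    final κ (addSeq κ μ)                     ≡⟨ A.ends ⟩
    μ                                        ∎
    where open ≡-Reasoning

  segment-length : length (segment ν κ μ) ≡ (size ν ∸ size κ) + (size μ ∸ size κ)
  segment-length = trans (length-++ (removeSeq ν κ)) (cong₂ _+_
    (trans (sym (m+n∸n≡m (length (removeSeq ν κ)) (sum κ))) (cong (_∸ sum κ) R.length≡))
    (trans (sym (m+n∸m≡n (sum κ) (length (addSeq κ μ)))) (cong (_∸ sum κ) A.length≡)))

  segment-linked : Linked Joins (stepsOf (ν ∷ segment ν κ μ))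
  segment-linked rewrite stepsOf-++ ν (removeSeq ν κ) (addSeq κ μ) | R.ends =
    linked-deletions-++-additions _ _
      (All.map (λ (r , c , s≡ , _) → (r , c) , s≡) R.left)
      (All.map (λ (r , c , s≡ , _) → (r , c) , s≡) A.right)
      R.linked A.linked

Move : List ℕ → List ℕ → Set
Move P Q = P ⊲ Q ⊎ Q ⊲ P

additions : ∀ {a x y A r} → ExtendsAt y x r → a ≤ part x r → Linked Move (y ∷ A) →
  Linked Joins (stepsOf (x ∷ y ∷ A)) → RightwardAdditions a x (y ∷ A)
additions {A = []} {r} ext a≤xr _ _ = add r ext a≤xr done
additions {x = x} {y} {z ∷ A} {r} ext a≤xr (inj₁ y⊲z ∷ moves) (j ∷ js) with ⊲⇒ExtendsAt y z y⊲z
... | r′ , ext′ = add r ext a≤xr (additions ext′ (proj₂ (joins-additions⁻¹ {r = r} {r′ = r′} j′)) moves js)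
  where
  j′ : Joins (true , r , part x r) (true , r′ , part y r′)
  j′ = subst₂ Joins (step-addition ext) (step-addition ext′) j
additions {y = y} {z ∷ A} ext _ (inj₂ z⊲y ∷ _) (j ∷ _) with ⊲⇒ExtendsAt z y z⊲y
... | _ , ext′ = ⊥-elim (subst₂ Joins (step-addition ext) (step-deletion ext′) j)

record Valley (t : ℕ) (x : List ℕ) (D : List (List ℕ)) : Set where
  field
    down up   : List (List ℕ)
    D≡        : D ≡ down ++ up
    leftward  : LeftwardDeletions t x down
    rightward : RightwardAdditions 0 (final x down) up

descend : ∀ {t x y D r} → ExtendsAt x y r → part y r < t → Linked Move (y ∷ D) →
  Linked Joins (stepsOf (x ∷ y ∷ D)) → Valley t x (y ∷ D)
descend {D = []} {r} ext yr<t _ _ = record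
  { down = _ ∷ [] ; up = [] ; D≡ = refl ; leftward = delete r ext yr<t done ; rightward = done }
descend {y = y} {z ∷ D} {r} ext yr<t (inj₁ y⊲z ∷ moves) (_ ∷ js) with ⊲⇒ExtendsAt y z y⊲z
... | _ , ext′ = record
  { down = y ∷ [] ; up = z ∷ D ; D≡ = refl ; leftward = delete r ext yr<t done
  ; rightward = additions ext′ z≤n moves js }
descend {x = x} {y} {z ∷ D} {r} ext yr<t (inj₂ z⊲y ∷ moves) (j ∷ js) with ⊲⇒ExtendsAt z y z⊲y
... | r′ , ext′ = record
  { down = y ∷ Valley.down rest ; up = Valley.up rest ; D≡ = cong (y ∷_) (Valley.D≡ rest)
  ; leftward = delete r ext yr<t (Valley.leftward rest) ; rightward = Valley.rightward rest }
  where
  j′ : Joins (false , r , part y r) (false , r′ , part z r′)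
  j′ = subst₂ Joins (step-deletion ext) (step-deletion ext′) j
  rest : Valley (part y r) y (z ∷ D)
  rest = descend ext′ (proj₂ (joins-deletions⁻¹ {r = r} {r′ = r′} j′)) moves js

valley : ∀ x D → IsPartition x → Linked Move (x ∷ D) → Linked Joins (stepsOf (x ∷ D)) →
  Valley (part x 0) x D
valley x [] _ _ _ = record { down = [] ; up = [] ; D≡ = refl ; leftward = done ; rightward = done }
valley x (y ∷ D) px (inj₁ x⊲y ∷ moves) js with ⊲⇒ExtendsAt x y x⊲y
... | _ , ext = record
  { down = [] ; up = y ∷ D ; D≡ = refl ; leftward = done ; rightward = additions ext z≤n moves js }
valley x (y ∷ D) px (inj₂ y⊲x ∷ moves) js with ⊲⇒ExtendsAt y x y⊲x
... | r , ext = descend ext (<-≤-trans (subst (part y r <_) (sym (ExtendsAt.grown ext)) ≤-refl)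
                                      (part-antitone px z≤n)) moves js

final-partition : ∀ x L → All IsPartition (x ∷ L) → IsPartition (final x L)
final-partition x []      (px ∷ _)  = px
final-partition x (y ∷ L) (_ ∷ pys) = final-partition y L pys

block⇒segment : ∀ x sg → All IsPartition (x ∷ sg) → Linked Move (x ∷ sg) → Linked Joins (stepsOf (x ∷ sg)) →
  Σ (List ℕ) λ κ → StripStep x κ (final x sg) × sg ≡ segment x κ (final x sg)
block⇒segment x sg (px ∷ psg) moves js =
  κ , subst (λ μ → StripStep x κ μ × sg ≡ segment x κ μ) (sym μ≡) (strips , sg≡)
  where
  open Valley (valley x sg px moves js)
  κ μ : List ℕ
  κ = final x down
  μ = final κ up
  partitions : All IsPartition down × All IsPartition up
  partitions = All.++⁻ down (subst (All IsPartition) D≡ psg)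
  pκ : IsPartition κ
  pκ = final-partition x down (px ∷ proj₁ partitions)
  strips : StripStep x κ μ
  strips = record
    { ν-partition = px ; κ-partition = pκ ; μ-partition = final-partition κ up (pκ ∷ proj₂ partitions)
    ; κ≤ν = leftward-shrinks leftward ; κ≤μ = rightward-grows rightward
    ; ν/κ-strip = leftward-strip leftward ; μ/κ-strip = rightward-strip rightward }
  open StripStep strips
  sg≡ : sg ≡ segment x κ μ
  sg≡ = trans D≡ (cong₂ _++_
    (sym (RemovalSweep.removeSeq-unique x κ px pκ κ≤ν ν/κ-strip down leftward refl (proj₁ partitions)))
    (sym (AdditionSweep.addSeq-unique μ κ μ-partition κ≤μ μ/κ-strip up rightward refl (proj₂ partitions))))
  μ≡ : final x sg ≡ μ
  μ≡ = trans (cong (final x) D≡) (final-++ x down up)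

-- Descent compositions

sum-∷ʳ : ∀ pre j → sum (pre ++ j ∷ []) ≡ sum pre + j
sum-∷ʳ pre j = trans (sum-++ pre (j ∷ [])) (cong (sum pre +_) (+-identityʳ j))

-- Reading `r ++ concat cs` after `prev`: `pre` holds the lengths of the runs already closed in the
-- current descent block, and `j ≥ 1` steps of the current run `prev ∷ r` have been read.
block-refines : ∀ pre j prev r cs → StrongComp pre → 0 < j → Linked Joins (prev ∷ r) →
  StrongComp (map length cs) → All (Linked Joins) cs →
  Refines (pre ++ (j + length r) ∷ map length cs) (desGo prev (sum pre + j) (r ++ concat cs))
block-refines pre j prev (t ∷ r) cs pos j>0 (j′ ∷ lr) poss lcs rewrite Equivalence.to T-≡ j′ =
  subst₂ Refines (cong (λ m → pre ++ m ∷ map length cs) (sym (+-suc j (length r))))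
                 (cong (λ k → desGo t k (r ++ concat cs)) (+-suc (sum pre) j))
    (block-refines pre (suc j) t r cs pos z<s lr poss lcs)
block-refines pre j prev [] [] pos j>0 _ _ _ rewrite +-identityʳ j =
  (pre ++ j ∷ []) ∷ [] , ++-identityʳ _ , (All.++⁺ pos (j>0 ∷ []) , sum-∷ʳ pre j) ∷ []
block-refines pre j prev [] ((t ∷ c) ∷ cs) pos j>0 _ (_ ∷ poss) (lc ∷ lcs) rewrite +-identityʳ j
  with joins prev t
... | true  = subst₂ Refines (++-assoc pre (j ∷ []) _)
                (cong (λ k → desGo t k (c ++ concat cs))
                      (trans (+-suc _ 0) (cong suc (trans (+-identityʳ _) (sum-∷ʳ pre j)))))
                (block-refines (pre ++ j ∷ []) 1 t c cs (All.++⁺ pos (j>0 ∷ [])) z<s lc poss lcs)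
... | false with block-refines [] 1 t c cs [] z<s lc poss lcs
...   | bs , concat≡ , blocks = subst (λ b → Refines b (sum pre + j ∷ desGo t 1 (c ++ concat cs)))
          (++-assoc pre (j ∷ []) _)
          ((pre ++ j ∷ []) ∷ bs , cong ((pre ++ j ∷ []) ++_) concat≡
          , (All.++⁺ pos (j>0 ∷ []) , sum-∷ʳ pre j) ∷ blocks)

runs-refine-des : ∀ cs → StrongComp (map length cs) → All (Linked Joins) cs →
  Refines (map length cs) (desSteps (concat cs))
runs-refine-des []             _          _          = [] , refl , []
runs-refine-des ((s ∷ c) ∷ cs) (_ ∷ poss) (lc ∷ lcs) = block-refines [] 1 s c cs [] z<s lc poss lcs

record FirstBlock (prev : Step) (k : ℕ) (ts : List Step) : Set where
  field
    run rest : List Step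
    ts≡      : ts ≡ run ++ rest
    linked   : Linked Joins (prev ∷ run)
    desGo≡   : desGo prev k ts ≡ (k + length run) ∷ desSteps rest

desGo-joined : ∀ prev k t ts → joins prev t ≡ true → desGo prev k (t ∷ ts) ≡ desGo t (suc k) ts
desGo-joined prev k t ts j rewrite j = refl

desGo-split : ∀ prev k t ts → joins prev t ≡ false → desGo prev k (t ∷ ts) ≡ k ∷ desGo t 1 ts
desGo-split prev k t ts j rewrite j = refl

firstBlock : ∀ prev k ts → FirstBlock prev k ts
firstBlock prev k [] = record
  { run = [] ; rest = [] ; ts≡ = refl ; linked = [-] ; desGo≡ = cong (_∷ []) (sym (+-identityʳ k)) }
firstBlock prev k (t ∷ ts) with joins prev t in j
... | true = record
  { run = t ∷ run ; rest = rest ; ts≡ = cong (t ∷_) ts≡ ; linked = subst T (sym j) tt ∷ linked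
  ; desGo≡ = trans (desGo-joined prev k t ts j)
                   (trans desGo≡ (cong (_∷ desSteps rest) (sym (+-suc k (length run))))) }
  where open FirstBlock (firstBlock t (suc k) ts)
... | false = record
  { run = [] ; rest = t ∷ ts ; ts≡ = refl ; linked = [-]
  ; desGo≡ = trans (desGo-split prev k t ts j) (cong (_∷ desGo t 1 ts) (sym (+-identityʳ k))) }

Linked-++⁻ : ∀ {A : Set} {R : A → A → Set} xs {ys} → Linked R (xs ++ ys) → Linked R xs × Linked R ys
Linked-++⁻ []           l        = [] , l
Linked-++⁻ (x ∷ [])     l        = [-] , Linked.tail l
Linked-++⁻ (x ∷ y ∷ xs) (r ∷ l) with Linked-++⁻ (y ∷ xs) l
... | lxs , lys = r ∷ lxs , lys

chop : ∀ {A : Set} ns (xs : List A) → sum ns ≡ length xs →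
  Σ (List (List A)) λ cs → concat cs ≡ xs × map length cs ≡ ns
chop []       []      _ = [] , refl , refl
chop (m ∷ ns) xs      e
  with chop ns (drop m xs) (trans (sym (m+n∸m≡n m (sum ns))) (trans (cong (_∸ m) e) (sym (length-drop m xs))))
... | cs , concat≡ , lengths≡ =
  take m xs ∷ cs , trans (cong (take m xs ++_) concat≡) (take++drop≡id m xs)
  , cong₂ _∷_ (trans (length-take m xs) (m≤n⇒m⊓n≡m (subst (m ≤_) e (m≤m+n m (sum ns))))) lengths≡

Linked-chop : ∀ {A : Set} {R : A → A → Set} cs → Linked R (concat cs) → All (Linked R) cs
Linked-chop []       _ = []
Linked-chop (c ∷ cs) l with Linked-++⁻ c l
... | lc , lcs = lc ∷ Linked-chop cs lcs

Block : List ℕ → ℕ → Set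
Block blk m = All (0 <_) blk × sum blk ≡ m

length-concat : ∀ {A : Set} (cs : List (List A)) → length (concat cs) ≡ sum (map length cs)
length-concat []       = refl
length-concat (c ∷ cs) = trans (length-++ c) (cong (length c +_) (length-concat cs))

blocks⇒runs : ∀ bs ss → Pointwise Block bs (desSteps ss) →
  Σ (List (List Step)) λ cs → concat cs ≡ ss × map length cs ≡ concat bs × All (Linked Joins) cs
blocks⇒runs []         []       []  = [] , refl , refl , []
blocks⇒runs []         (s ∷ ss) pw
  with () ← subst (Pointwise Block []) (FirstBlock.desGo≡ (firstBlock s 1 ss)) pw
blocks⇒runs (blk ∷ bs) (s ∷ ss) pw  with firstBlock s 1 ss
... | record { run = run ; rest = rest ; ts≡ = refl ; linked = linked ; desGo≡ = desGo≡ }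
  with subst (Pointwise Block (blk ∷ bs)) desGo≡ pw
... | (_ , sum≡) ∷ pw′ with chop blk (s ∷ run) sum≡ | blocks⇒runs bs rest pw′
... | cs₁ , concat≡₁ , lengths≡₁ | cs₂ , concat≡₂ , lengths≡₂ , linked₂ =
  cs₁ ++ cs₂
  , trans (sym (concat-++ cs₁ cs₂)) (cong₂ _++_ concat≡₁ concat≡₂)
  , trans (map-++ length cs₁ cs₂) (cong₂ _++_ lengths≡₁ lengths≡₂)
  , All.++⁺ (Linked-chop cs₁ (subst (Linked Joins) (sym concat≡₁) linked)) linked₂

refines-des⇒runs : ∀ b ss → Refines b (desSteps ss) →
  Σ (List (List Step)) λ cs → concat cs ≡ ss × map length cs ≡ b × All (Linked Joins) cs
refines-des⇒runs b ss (bs , concat≡ , blocks) with blocks⇒runs bs ss blocks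
... | cs , concat≡′ , lengths≡ , linked = cs , concat≡′ , trans lengths≡ concat≡ , linked

runsOf : List ℕ → List (List (List ℕ)) → List (List Step)
runsOf x []         = []
runsOf x (sg ∷ sgs) = stepsOf (x ∷ sg) ∷ runsOf (final x sg) sgs

stepsOf-concat : ∀ x sgs → stepsOf (x ∷ concat sgs) ≡ concat (runsOf x sgs)
stepsOf-concat x []         = refl
stepsOf-concat x (sg ∷ sgs) =
  trans (stepsOf-++ x sg (concat sgs)) (cong (stepsOf (x ∷ sg) ++_) (stepsOf-concat (final x sg) sgs))

length-stepsOf : ∀ x L → length (stepsOf (x ∷ L)) ≡ length L
length-stepsOf x []      = refl
length-stepsOf x (y ∷ L) = cong suc (length-stepsOf y L)

lengths-runsOf : ∀ x sgs → map length (runsOf x sgs) ≡ map length sgs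
lengths-runsOf x []         = refl
lengths-runsOf x (sg ∷ sgs) = cong₂ _∷_ (length-stepsOf x sg) (lengths-runsOf (final x sg) sgs)

part-positive : ∀ {b} → StrongComp b → ∀ {i} → i < length b → 0 < part b i
part-positive (p ∷ _)  {zero}  _       = p
part-positive (_ ∷ ps) {suc i} (s≤s i<) = part-positive ps i<

part-beyond : ∀ b {i} → length b ≤ i → part b i ≡ 0
part-beyond []      _         = refl
part-beyond (_ ∷ b) (s≤s b≤i) = part-beyond b b≤i

map-interval-suc : ∀ {A : Set} (f : ℕ → A) a m → map f (interval (suc a) m) ≡ map (f ∘ suc) (interval a m)
map-interval-suc f a zero    = refl
map-interval-suc f a (suc m) = cong (f (suc a) ∷_) (map-interval-suc f (suc a) m)

map-part-interval : ∀ b → map (part b) (interval 0 (length b)) ≡ b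
map-part-interval []      = refl
map-part-interval (x ∷ b) =
  cong (x ∷_) (trans (map-interval-suc (part (x ∷ b)) 0 (length b)) (map-part-interval b))

interval-++ : ∀ a m p → interval a (m + p) ≡ interval a m ++ interval (a + m) p
interval-++ a zero    p = cong (λ a′ → interval a′ p) (sym (+-identityʳ a))
interval-++ a (suc m) p = cong (a ∷_) (trans (interval-++ (suc a) m p)
  (cong (λ a′ → interval (suc a) m ++ interval a′ p) (sym (+-suc a m))))

concat-map-interval-truncate : ∀ {A : Set} (f : ℕ → List A) {m k} → m ≤ k → (∀ {i} → m ≤ i → f i ≡ []) →
  concat (map f (interval 0 k)) ≡ concat (map f (interval 0 m))
concat-map-interval-truncate f {m} {k} m≤k empty = begin
  concat (map f (interval 0 k))
    ≡⟨ cong (concat ∘ map f ∘ interval 0) (m+[n∸m]≡n m≤k) ⟨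
  concat (map f (interval 0 (m + (k ∸ m))))
    ≡⟨ cong (concat ∘ map f) (interval-++ 0 m (k ∸ m)) ⟩
  concat (map f (interval 0 m ++ interval m (k ∸ m)))
    ≡⟨ cong concat (map-++ f (interval 0 m) _) ⟩
  concat (map f (interval 0 m) ++ map f (interval m (k ∸ m)))
    ≡⟨ concat-++ (map f (interval 0 m)) _ ⟨
  concat (map f (interval 0 m)) ++ concat (map f (interval m (k ∸ m)))
    ≡⟨ cong (concat (map f (interval 0 m)) ++_) (beyond m (k ∸ m) ≤-refl) ⟩
  concat (map f (interval 0 m)) ++ []
    ≡⟨ ++-identityʳ _ ⟩
  concat (map f (interval 0 m)) ∎
  where
  open ≡-Reasoning
  beyond : ∀ a p → m ≤ a → concat (map f (interval a p)) ≡ []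
  beyond a zero    _   = refl
  beyond a (suc p) m≤a rewrite empty m≤a = beyond (suc a) p (m≤n⇒m≤1+n m≤a)

-- From SSOTs to refinements

module _ {lam : List ℕ} (T : SSOT lam) where

  stripStepAt : ∀ i → StripStep (S T i) (S′ T i) (S T (suc i))
  stripStepAt i = record
    { ν-partition = S-part T i ; κ-partition = S′-part T i ; μ-partition = S-part T (suc i)
    ; κ≤ν = ⊆P⇒part≤ (S′ T i) (S T i) (sub-left T i)
    ; κ≤μ = ⊆P⇒part≤ (S′ T i) (S T (suc i)) (sub-right T i)
    ; ν/κ-strip = strip-left T i ; μ/κ-strip = strip-right T i }

  segmentAt : ℕ → List (List ℕ)
  segmentAt i = segment (S T i) (S′ T i) (S T (suc i))

  runAt : ℕ → List Step
  runAt i = stepsOf (S T i ∷ segmentAt i)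

  runsOf-segments : ∀ a m → runsOf (S T a) (map segmentAt (interval a m)) ≡ map runAt (interval a m)
  runsOf-segments a zero    = refl
  runsOf-segments a (suc m) = cong (runAt a ∷_) (trans
    (cong (λ x → runsOf x (map segmentAt (interval (suc a) m))) (segment-final (stripStepAt a)))
    (runsOf-segments (suc a) m))

  length-runAt : ∀ i → length (runAt i) ≡ mult T i
  length-runAt i = trans (length-stepsOf (S T i) (segmentAt i)) (segment-length (stripStepAt i))

  mult-stable : ∀ {i} → stab T ≤ i → mult T i ≡ 0
  mult-stable {i} stab≤i
    rewrite proj₁ (stable T i stab≤i) | proj₂ (stable T i stab≤i)
          | proj₁ (stable T (suc i) (m≤n⇒m≤1+n stab≤i)) =
    cong₂ _+_ (n∸n≡0 (size lam)) (n∸n≡0 (size lam))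

  stepsOf-std : stepsOf (std T) ≡ concat (map runAt (interval 0 (stab T)))
  stepsOf-std = begin
    stepsOf ([] ∷ concat (map segmentAt (upTo (stab T))))
      ≡⟨ cong₂ (λ x cs → stepsOf (x ∷ concat (map segmentAt cs))) (sym (S-zero T)) (upTo≡interval (stab T)) ⟩
    stepsOf (S T 0 ∷ concat (map segmentAt (interval 0 (stab T))))
      ≡⟨ stepsOf-concat (S T 0) (map segmentAt (interval 0 (stab T))) ⟩
    concat (runsOf (S T 0) (map segmentAt (interval 0 (stab T))))
      ≡⟨ cong concat (runsOf-segments 0 (stab T)) ⟩
    concat (map runAt (interval 0 (stab T))) ∎
    where open ≡-Reasoning

  module _ (b : List ℕ) (strong : StrongComp b) (com : ComEq T b) where

    length≤stab : length b ≤ stab T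
    length≤stab with length b ≤? stab T
    ... | yes ≤stab = ≤stab
    ... | no  ≰stab = contradiction (trans (sym (com (stab T))) (mult-stable ≤-refl))
                        (≢-sym (<⇒≢ (part-positive strong (≰⇒> ≰stab))))

    runAt-beyond : ∀ {i} → length b ≤ i → runAt i ≡ []
    runAt-beyond b≤i = length≡0⇒[] (trans (length-runAt _) (trans (com _) (part-beyond b b≤i)))
      where
      length≡0⇒[] : ∀ {xs : List Step} → length xs ≡ 0 → xs ≡ []
      length≡0⇒[] {[]} _ = refl

    stepsOf-std-runs : stepsOf (std T) ≡ concat (map runAt (interval 0 (length b)))
    stepsOf-std-runs = trans stepsOf-std (concat-map-interval-truncate runAt length≤stab runAt-beyond)

    lengths-runs : map length (map runAt (interval 0 (length b))) ≡ b
    lengths-runs = begin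
      map length (map runAt (interval 0 (length b))) ≡⟨ map-∘ (interval 0 (length b)) ⟨
      map (length ∘ runAt) (interval 0 (length b))   ≡⟨ map-cong (λ i → trans (length-runAt i) (com i)) _ ⟩
      map (part b) (interval 0 (length b))           ≡⟨ map-part-interval b ⟩
      b                                              ∎
      where open ≡-Reasoning

    com⇒refines-des : Refines b (des (std T))
    com⇒refines-des = subst₂ Refines lengths-runs (cong desSteps (sym stepsOf-std-runs))
      (runs-refine-des (map runAt (interval 0 (length b)))
        (subst StrongComp (sym lengths-runs) strong)
        (All.map⁺ (All.universal (λ i → segment-linked (stripStepAt i)) _)))

-- From refinements to SSOTs

shapeAt innerAt : List (List ℕ × List ℕ) → List ℕ → ℕ → List ℕ
shapeAt []            fin _       = fin
shapeAt ((ν , _) ∷ _)  _  zero    = ν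
shapeAt (_ ∷ ps)      fin (suc i) = shapeAt ps fin i
innerAt []            fin _       = fin
innerAt ((_ , κ) ∷ _)  _  zero    = κ
innerAt (_ ∷ ps)      fin (suc i) = innerAt ps fin i

StripChain : List (List ℕ × List ℕ) → List ℕ → Set
StripChain []             fin = IsPartition fin
StripChain ((ν , κ) ∷ ps) fin = StripStep ν κ (shapeAt ps fin 0) × StripChain ps fin

segmentsOf : List (List ℕ × List ℕ) → List ℕ → List (List (List ℕ))
segmentsOf []             fin = []
segmentsOf ((ν , κ) ∷ ps) fin = segment ν κ (shapeAt ps fin 0) ∷ segmentsOf ps fin

chainSegment : List (List ℕ × List ℕ) → List ℕ → ℕ → List (List ℕ)
chainSegment ps fin i = segment (shapeAt ps fin i) (innerAt ps fin i) (shapeAt ps fin (suc i))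

segmentsOf≡applyUpTo : ∀ ps fin → segmentsOf ps fin ≡ applyUpTo (chainSegment ps fin) (length ps)
segmentsOf≡applyUpTo []             fin = refl
segmentsOf≡applyUpTo ((ν , κ) ∷ ps) fin = cong (segment ν κ (shapeAt ps fin 0) ∷_) (segmentsOf≡applyUpTo ps fin)

stripStep-refl : ∀ {ν} → IsPartition ν → StripStep ν ν ν
stripStep-refl pν = record
  { ν-partition = pν ; κ-partition = pν ; μ-partition = pν ; κ≤ν = λ _ → ≤-refl ; κ≤μ = λ _ → ≤-refl
  ; ν/κ-strip = λ _ _ _ (inside , outside) _ → contradiction inside outside
  ; μ/κ-strip = λ _ _ _ (inside , outside) _ → contradiction inside outside }

module _ (ps : List (List ℕ × List ℕ)) (fin : List ℕ) (chain : StripChain ps fin) where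

  chain-step : ∀ i → StripStep (shapeAt ps fin i) (innerAt ps fin i) (shapeAt ps fin (suc i))
  chain-step = go ps chain
    where
    go : ∀ ps → StripChain ps fin → ∀ i → StripStep (shapeAt ps fin i) (innerAt ps fin i) (shapeAt ps fin (suc i))
    go []      pfin        _       = stripStep-refl pfin
    go (_ ∷ _) (step , _)  zero    = step
    go (_ ∷ ps) (_ , rest) (suc i) = go ps rest i

  chain-stable : ∀ i → length ps ≤ i → shapeAt ps fin i ≡ fin × innerAt ps fin i ≡ fin
  chain-stable = go ps
    where
    go : ∀ ps i → length ps ≤ i → shapeAt ps fin i ≡ fin × innerAt ps fin i ≡ fin
    go []       _       _         = refl , refl
    go (_ ∷ ps) (suc i) (s≤s ≤i) = go ps i ≤i

  toSSOT : shapeAt ps fin 0 ≡ [] → SSOT fin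
  toSSOT starts = record
    { S = shapeAt ps fin ; S′ = innerAt ps fin
    ; S-part = ν-partition ∘ chain-step ; S′-part = κ-partition ∘ chain-step
    ; S-zero = starts
    ; S′-zero = ≈ₚ-partition⇒≡ _ [] ([] , [])
        (λ k → n≤0⇒n≡0 (subst (λ ν → part (innerAt ps fin 0) k ≤ part ν k) starts (κ≤ν (chain-step 0) k)))
        (trim-partition (κ-partition (chain-step 0)))
    ; sub-left = λ i → part≤⇒⊆P (innerAt ps fin i) (shapeAt ps fin i) (κ≤ν (chain-step i))
    ; sub-right = λ i → part≤⇒⊆P (innerAt ps fin i) (shapeAt ps fin (suc i)) (κ≤μ (chain-step i))
    ; strip-left = ν/κ-strip ∘ chain-step ; strip-right = μ/κ-strip ∘ chain-step
    ; stab = length ps ; stable = chain-stable }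
    where open StripStep

  module _ (starts : shapeAt ps fin 0 ≡ []) where

    mult-toSSOT : ∀ i → mult (toSSOT starts) i ≡ length (chainSegment ps fin i)
    mult-toSSOT i = sym (segment-length (chain-step i))

    comEq-toSSOT : ComEq (toSSOT starts) (map length (segmentsOf ps fin))
    comEq-toSSOT i = trans (mult-toSSOT i) (go ps chain i)
      where
      go : ∀ ps → StripChain ps fin → ∀ i → length (chainSegment ps fin i) ≡ part (map length (segmentsOf ps fin)) i
      go []      pfin _       = trans (segment-length (stripStep-refl pfin))
                                      (cong₂ _+_ (n∸n≡0 (size fin)) (n∸n≡0 (size fin)))
      go (_ ∷ _)  _   zero    = refl
      go (_ ∷ ps) (_ , rest) (suc i) = go ps rest i

    length-toSSOT : ssotLength (toSSOT starts) ≡ sum (map length (segmentsOf ps fin))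
    length-toSSOT = cong sum (begin
      map (mult (toSSOT starts)) (upTo (length ps))        ≡⟨ map-cong mult-toSSOT (upTo (length ps)) ⟩
      map (length ∘ chainSegment ps fin) (upTo (length ps)) ≡⟨ map-∘ (upTo (length ps)) ⟩
      map length (map (chainSegment ps fin) (upTo (length ps))) ≡⟨ cong (map length) segments≡ ⟩
      map length (segmentsOf ps fin)                        ∎)
      where
      open ≡-Reasoning
      segments≡ : map (chainSegment ps fin) (upTo (length ps)) ≡ segmentsOf ps fin
      segments≡ = trans (map-upTo (chainSegment ps fin) (length ps)) (sym (segmentsOf≡applyUpTo ps fin))

    std-toSSOT : std (toSSOT starts) ≡ [] ∷ concat (segmentsOf ps fin)
    std-toSSOT = cong (λ sgs → [] ∷ concat sgs)
      (trans (map-upTo (chainSegment ps fin) (length ps)) (sym (segmentsOf≡applyUpTo ps fin)))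

All-split : ∀ {P : List ℕ → Set} x s r → All P (x ∷ s ++ r) → All P (x ∷ s) × All P (final x s ∷ r)
All-split x []      r (px ∷ ps) = px ∷ [] , px ∷ ps
All-split x (y ∷ s) r (px ∷ ps) with All-split y s r ps
... | left , right = px ∷ left , right

Linked-split : ∀ {R : List ℕ → List ℕ → Set} x s r → Linked R (x ∷ s ++ r) →
  Linked R (x ∷ s) × Linked R (final x s ∷ r)
Linked-split x []      r l       = [-] , l
Linked-split x (y ∷ s) r (xy ∷ l) with Linked-split y s r l
... | left , right = xy ∷ left , right

record Assembled (x : List ℕ) (sgs : List (List (List ℕ))) : Set where
  field
    pairs     : List (List ℕ × List ℕ)
    chain     : StripChain pairs (final x (concat sgs))
    segments≡ : sgs ≡ segmentsOf pairs (final x (concat sgs))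
    starts    : shapeAt pairs (final x (concat sgs)) 0 ≡ x

assemble : ∀ x sgs → All IsPartition (x ∷ concat sgs) → Linked Move (x ∷ concat sgs) →
  All (Linked Joins) (runsOf x sgs) → Assembled x sgs
assemble x [] (px ∷ _) _ _ = record { pairs = [] ; chain = px ; segments≡ = refl ; starts = refl }
assemble x (sg ∷ sgs) psh moves (run ∷ runs) = record
  { pairs     = (x , κ) ∷ pairs
  ; chain     = subst (StripChain ((x , κ) ∷ pairs)) (sym fin≡)
                  (subst (StripStep x κ) (sym starts) strips , chain)
  ; segments≡ = subst (λ f → sg ∷ sgs ≡ segmentsOf ((x , κ) ∷ pairs) f) (sym fin≡)
                  (cong₂ _∷_ (trans sg≡ (cong (segment x κ) (sym starts))) segments≡)
  ; starts    = refl }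
  where
  shapes : All IsPartition (x ∷ sg) × All IsPartition (final x sg ∷ concat sgs)
  shapes = All-split x sg (concat sgs) psh
  steps : Linked Move (x ∷ sg) × Linked Move (final x sg ∷ concat sgs)
  steps = Linked-split x sg (concat sgs) moves
  open Assembled (assemble (final x sg) sgs (proj₂ shapes) (proj₂ steps) runs)
  block : Σ (List ℕ) λ κ → StripStep x κ (final x sg) × sg ≡ segment x κ (final x sg)
  block = block⇒segment x sg (proj₁ shapes) (proj₁ steps) run
  κ : List ℕ
  κ = proj₁ block
  strips : StripStep x κ (final x sg)
  strips = proj₁ (proj₂ block)
  sg≡ : sg ≡ segment x κ (final x sg)
  sg≡ = proj₂ (proj₂ block)
  fin≡ : final x (sg ++ concat sgs) ≡ final (final x sg) (concat sgs)
  fin≡ = final-++ x sg (concat sgs)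

segments⇒InC : ∀ sgs → All IsPartition ([] ∷ concat sgs) → Linked Move ([] ∷ concat sgs) →
  All (Linked Joins) (runsOf [] sgs) →
  InC (final [] (concat sgs)) (sum (map length sgs)) ([] ∷ concat sgs) (map length sgs)
segments⇒InC sgs shapes moves runs = toSSOT pairs fin chain starts , length≡ , std≡ , com≡
  where
  open Assembled (assemble [] sgs shapes moves runs)
  fin : List ℕ
  fin = final [] (concat sgs)
  length≡ : ssotLength (toSSOT pairs fin chain starts) ≡ sum (map length sgs)
  length≡ = trans (length-toSSOT pairs fin chain starts) (cong (sum ∘ map length) (sym segments≡))
  std≡ : std (toSSOT pairs fin chain starts) ≡ [] ∷ concat sgs
  std≡ = trans (std-toSSOT pairs fin chain starts) (cong (λ sgs → [] ∷ concat sgs) (sym segments≡))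
  com≡ : ComEq (toSSOT pairs fin chain starts) (map length sgs)
  com≡ i = trans (comEq-toSSOT pairs fin chain starts i) (cong (λ sgs → part (map length sgs) i) (sym segments≡))

++-cancel-length : ∀ {A : Set} (a b x y : List A) → a ++ x ≡ b ++ y → length a ≡ length b → a ≡ b × x ≡ y
++-cancel-length []      []      x y e _ = refl , e
++-cancel-length (u ∷ a) (w ∷ b) x y e l with ++-cancel-length a b x y (∷-injectiveʳ e) (suc-injective l)
... | a≡b , x≡y = cong₂ _∷_ (∷-injectiveˡ e) a≡b , x≡y

concat-injective : ∀ {A : Set} (as bs : List (List A)) → concat as ≡ concat bs →
  map length as ≡ map length bs → as ≡ bs
concat-injective []       []       _ _ = refl
concat-injective (a ∷ as) (b ∷ bs) e l with ++-cancel-length a b (concat as) (concat bs) e (∷-injectiveˡ l)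
... | a≡b , rest≡ = cong₂ _∷_ a≡b (concat-injective as bs rest≡ (∷-injectiveʳ l))

refines-des⇒segments : ∀ x rest b → Refines b (des (x ∷ rest)) →
  Σ (List (List (List ℕ))) λ sgs → concat sgs ≡ rest × map length sgs ≡ b × All (Linked Joins) (runsOf x sgs)
refines-des⇒segments x rest b refines with refines-des⇒runs b (stepsOf (x ∷ rest)) refines
... | cs , concat≡ , lengths≡ , linked with chop b rest sum≡
  where
  sum≡ : sum b ≡ length rest
  sum≡ = begin
    sum b                        ≡⟨ cong sum lengths≡ ⟨
    sum (map length cs)          ≡⟨ length-concat cs ⟨
    length (concat cs)           ≡⟨ cong length concat≡ ⟩
    length (stepsOf (x ∷ rest))  ≡⟨ length-stepsOf x rest ⟩
    length rest                  ∎
    where open ≡-Reasoning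
... | sgs , concat≡′ , lengths≡′ = sgs , concat≡′ , lengths≡′ , subst (All (Linked Joins)) (sym runs≡) linked
  where
  runs≡ : runsOf x sgs ≡ cs
  runs≡ = concat-injective (runsOf x sgs) cs
    (trans (sym (stepsOf-concat x sgs)) (trans (cong (λ r → stepsOf (x ∷ r)) concat≡′) (sym concat≡)))
    (trans (lengths-runsOf x sgs) (trans lengths≡′ (sym lengths≡)))

last≡final : ∀ x L → last (x ∷ L) ≡ just (final x L)
last≡final x []      = refl
last≡final x (y ∷ L) = last≡final y L

refines-des⇒inC : ∀ lam n O → IsOT lam n O → ∀ b → Refines b (des O) → InC lam n O b
refines-des⇒inC lam n []         ot _ _ with () ← IsOT.len ot
refines-des⇒inC lam n (x ∷ rest) ot b refines
  with refines-des⇒segments x rest b refines | just-injective (IsOT.start ot)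
... | sgs , refl , refl , runs | refl = subst₂ (λ l m → InC l m ([] ∷ concat sgs) (map length sgs))
  (just-injective (trans (sym (last≡final [] (concat sgs))) (IsOT.end ot)))
  (trans (sym (length-concat sgs)) (suc-injective (IsOT.len ot)))
  (segments⇒InC sgs (IsOT.allPart ot) (IsOT.moves ot) runs)

lemma2p19 : (lam : List ℕ) → IsPartition lam → (n : ℕ) → InN lam n →
    (O : List (List ℕ)) → IsOT lam n O →
    (b : List ℕ) → (StrongComp b × InC lam n O b) ⇔ InRef (des O) b
lemma2p19 lam _ n _ O ot b = mk⇔ to from
  -- That λ is a partition and n ∈ N(λ) already follow from O ∈ OT_n(λ).
  where
  to : StrongComp b × InC lam n O b → InRef (des O) b
  to (strong , T , _ , std≡O , com) =
    strong , subst (λ O → Refines b (des O)) std≡O (com⇒refines-des T b strong com)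
  from : InRef (des O) b → StrongComp b × InC lam n O b
  from (strong , refines) = strong , refines-des⇒inC lam n O ot b refines
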